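{- Let $\mathcal{G}$ be a finite triangulation of a closed orientable surface whose faces are properly $2$-coloured black and white and whose vertex set $V$ has a proper vertex $3$-colouring $V=R\cup C\cup S$ (every triangle has exactly one vertex in each of $R,C,S$), with $R=\{r_1,\dots,r_k\}$. Define $T=(t_{ij})$ by: for $i\ne j$, $t_{ij}$ is the number of edges $e$ with one end in $C$ and one in $S$ such that the white triangle containing $e$ has vertex $r_j$ and the black triangle containing $e$ has vertex $r_i$; $t_{ii}=-\sum_{j\ne i}t_{ij}$. Define $T'$ in the same way with black and white interchanged. Let $\mathcal{B}_W$ (resp. $\mathcal{B}_B$) be the abelian group generated by $x_1,\dots,x_k$ subject to $\sum_j t_{ij}x_j=0$ (resp. $\sum_j t'_{ij}x_j=0$) for $1\le i\le k$, and let $\mathcal{A}_W$ (resp. $\mathcal{A}_B$) be the abelian group generated by $V$ subject to $r+c+s=0$ for every white (resp. black) triangle with vertex set $\{r,c,s\}$. Then $\mathcal{B}_W\cong\mathcal{B}_B$, the torsion subgroup $\mathcal{C}_W$ of $\mathcal{B}_W$ is finite, and $\mathcal{A}_W\cong\mathbb{Z}\oplus\mathbb{Z}\oplus M$ and $\mathcal{A}_B\cong\mathbb{Z}\oplus\mathbb{Z}\oplus N$ where $M$ and $N$ are quotients of $\mathcal{C}_W$.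
   Context: A triangulation of a surface is a $2$-cell embedding of a finite graph (multiple edges allowed, no loops) in the surface in which every face is bounded by a $3$-cycle with three distinct vertices; "properly $2$-coloured" means no two faces of the same colour share an edge, so every edge lies in exactly one white and one black triangle. -}

module Defs where

open import Level using (0ℓ)
open import Data.Nat as ℕ using (ℕ; zero; suc; _<_)
open import Data.Nat.Properties as ℕP using ()
open import Data.Integer as ℤ using (ℤ; +_; 0ℤ; 1ℤ; -_; _-_)
open import Data.Integer.Properties as ℤP using ()
open import Data.Integer.Solver using (module +-*-Solver)
open import Data.Fin using (Fin; zero; suc; _≟_)
open import Data.Bool using (Bool; true; false; if_then_else_; _∧_)
open import Data.Sum using (_⊎_; inj₁; inj₂)
open import Data.Product using (Σ; ∃; ∃-syntax; _×_; _,_; proj₁; proj₂)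
open import Data.List using (List)
open import Data.List.Relation.Unary.Any using (Any)
open import Function using (_∘_; id)
open import Function.Bundles using (_↔_; Inverse)
open import Function.Definitions using (Surjective)
open import Relation.Nullary using (Dec; yes; no; ⌊_⌋)
open import Relation.Binary.PropositionalEquality as P using (_≡_)
open import Relation.Binary.Construct.Closure.Equivalence using (EqClosure)
open import Algebra.Bundles using (AbelianGroup; RawGroup)
open import Algebra.Morphism.Structures using (module GroupMorphisms)
import Algebra.Construct.DirectProduct as DP
import Algebra.Properties.Monoid.Mult as Mult
import Algebra.Properties.CommutativeMonoid.Mult as CMult
import Algebra.Properties.Group as GP
import Algebra.Properties.AbelianGroup as AGP
import Relation.Binary.Reasoning.Setoid as SetoidR

sumℤ : ∀ {n} → (Fin n → ℤ) → ℤ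
sumℤ {zero}  f = 0ℤ
sumℤ {suc n} f = f zero ℤ.+ sumℤ (f ∘ suc)

count : ∀ {n} → (Fin n → Bool) → ℕ
count {zero}  p = 0
count {suc n} p = (if p zero then 1 else 0) ℕ.+ count (p ∘ suc)

iter : ∀ {A : Set} → (A → A) → ℕ → A → A
iter f zero    a = a
iter f (suc m) a = f (iter f m a)

δ : ∀ {n} → Fin n → Fin n → ℤ
δ i j = if ⌊ i ≟ j ⌋ then 1ℤ else 0ℤ

module _ (G H : AbelianGroup 0ℓ 0ℓ) where
  open GroupMorphisms (AbelianGroup.rawGroup G) (AbelianGroup.rawGroup H)

  _≅_ : Set
  _≅_ = ∃[ f ] IsGroupIsomorphism f

  IsQuotientOf : Set
  IsQuotientOf = ∃[ f ] (IsGroupHomomorphism f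
                   × Surjective (AbelianGroup._≈_ G) (AbelianGroup._≈_ H) f)

FiniteGroup : AbelianGroup 0ℓ 0ℓ → Set
FiniteGroup G = ∃[ xs ] (∀ x → Any (x ≈_) xs)
  where open AbelianGroup G

ℤ-group : AbelianGroup 0ℓ 0ℓ
ℤ-group = ℤP.+-0-abelianGroup

ℤ²⊕ : AbelianGroup 0ℓ 0ℓ → AbelianGroup 0ℓ 0ℓ
ℤ²⊕ M = DP.abelianGroup ℤ-group (DP.abelianGroup ℤ-group M)

module Torsion (G : AbelianGroup 0ℓ 0ℓ) where
  open AbelianGroup G
  open Mult monoid renaming (_×_ to _·_) using ( ×-assocˡ; ×-congˡ; ×-homo-1)
  open CMult commutativeMonoid using (×-distrib-+)
  open GP group using (ε⁻¹≈ε)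
  open AGP G using (⁻¹-∙-comm)
  open SetoidR setoid

  IsTorsion : Carrier → Set
  IsTorsion x = ∃[ n ] (suc n · x ≈ ε)

  private
    ×-ε : ∀ n → n · ε ≈ ε
    ×-ε zero    = refl
    ×-ε (suc n) = trans (∙-congˡ (×-ε n)) (identityˡ ε)

    ×-⁻¹ : ∀ n x → n · (x ⁻¹) ≈ (n · x) ⁻¹
    ×-⁻¹ zero    x = sym ε⁻¹≈ε
    ×-⁻¹ (suc n) x = trans (∙-congˡ (×-⁻¹ n x)) (⁻¹-∙-comm x (n · x))

    swapMul : ∀ m n x → (suc m ℕ.* suc n) · x ≈ suc n · (suc m · x)
    swapMul m n x = begin
      (suc m ℕ.* suc n) · x ≈⟨ ×-congˡ (ℕP.*-comm (suc m) (suc n)) ⟩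
      (suc n ℕ.* suc m) · x ≈⟨ sym (×-assocˡ x (suc n) (suc m)) ⟩
      suc n · (suc m · x) ∎

    kill : ∀ m n x → suc m · x ≈ ε → suc n · (suc m · x) ≈ ε
    kill m n x p = trans (×-congʳ (suc n) p) (×-ε (suc n))
      where open Mult monoid using (×-congʳ)

    ∙-closed : ∀ {x y} → IsTorsion x → IsTorsion y → IsTorsion (x ∙ y)
    ∙-closed {x} {y} (m , p) (n , q) = n ℕ.+ m ℕ.* suc n , (begin
      (suc m ℕ.* suc n) · (x ∙ y)                 ≈⟨ ×-distrib-+ x y (suc m ℕ.* suc n) ⟩
      (suc m ℕ.* suc n) · x ∙ (suc m ℕ.* suc n) · y ≈⟨ ∙-cong (swapMul m n x) (×-congˡ′ (suc m) (suc n) y) ⟩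
      suc n · (suc m · x) ∙ suc m · (suc n · y)   ≈⟨ ∙-cong (kill m n x p) (kill n m y q) ⟩
      ε ∙ ε                                       ≈⟨ identityˡ ε ⟩
      ε ∎)
      where
      ×-congˡ′ : ∀ a b z → (a ℕ.* b) · z ≈ a · (b · z)
      ×-congˡ′ a b z = sym (×-assocˡ z a b)

    ⁻¹-closed : ∀ {x} → IsTorsion x → IsTorsion (x ⁻¹)
    ⁻¹-closed {x} (n , p) = n , trans (×-⁻¹ (suc n) x) (trans (⁻¹-cong p) ε⁻¹≈ε)

  torsionSubgroup : AbelianGroup 0ℓ 0ℓ
  torsionSubgroup = record
    { Carrier = Σ Carrier IsTorsion
    ; _≈_ = λ a b → proj₁ a ≈ proj₁ b
    ; _∙_ = λ a b → proj₁ a ∙ proj₁ b , ∙-closed (proj₂ a) (proj₂ b)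
    ; ε = ε , 0 , trans (identityʳ ε) refl
    ; _⁻¹ = λ a → proj₁ a ⁻¹ , ⁻¹-closed (proj₂ a)
    ; isAbelianGroup = record
      { isGroup = record
        { isMonoid = record
          { isSemigroup = record
            { isMagma = record
              { isEquivalence = record { refl = refl ; sym = sym ; trans = trans }
              ; ∙-cong = ∙-cong }
            ; assoc = λ a b c → assoc (proj₁ a) (proj₁ b) (proj₁ c) }
          ; identity = (λ a → identityˡ (proj₁ a)) , (λ a → identityʳ (proj₁ a)) }
        ; inverse = (λ a → inverseˡ (proj₁ a)) , (λ a → inverseʳ (proj₁ a))
        ; ⁻¹-cong = ⁻¹-cong }
      ; comm = λ a b → comm (proj₁ a) (proj₁ b) }
    }

-- Abelian group given by generators (a finite type Gen, so the free
-- abelian group on Gen is Gen → ℤ) and relators rel i (i : Rel):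
-- the quotient of the free abelian group by the subgroup generated
-- by the relators, as a setoid-based abelian group.

module Presentation {Gen Rel : Set} (rel : Rel → Gen → ℤ) where

  data Span : (Gen → ℤ) → Set where
    span-rel  : ∀ i → Span (rel i)
    span-zero : Span (λ _ → 0ℤ)
    span-add  : ∀ {x y} → Span x → Span y → Span (λ g → x g ℤ.+ y g)
    span-neg  : ∀ {x} → Span x → Span (λ g → - x g)
    span-ext  : ∀ {x y} → (∀ g → x g ≡ y g) → Span x → Span y

  _≈ₚ_ : (Gen → ℤ) → (Gen → ℤ) → Set
  x ≈ₚ y = Span (λ g → x g - y g)

  private
    open +-*-Solver
    l-refl : ∀ a → 0ℤ ≡ a - a
    l-refl = solve 1 (λ a → con 0ℤ := a :- a) P.refl
    l-sym : ∀ a b → - (a - b) ≡ b - a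
    l-sym = solve 2 (λ a b → :- (a :- b) := b :- a) P.refl
    l-trans : ∀ a b c → (a - b) ℤ.+ (b - c) ≡ a - c
    l-trans = solve 3 (λ a b c → (a :- b) :+ (b :- c) := a :- c) P.refl
    l-add : ∀ a b c d → (a - b) ℤ.+ (c - d) ≡ (a ℤ.+ c) - (b ℤ.+ d)
    l-add = solve 4 (λ a b c d → (a :- b) :+ (c :- d) := (a :+ c) :- (b :+ d)) P.refl
    l-neg : ∀ a b → - (a - b) ≡ (- a) - (- b)
    l-neg = solve 2 (λ a b → :- (a :- b) := (:- a) :- (:- b)) P.refl

    ≈-refl : ∀ {x} → x ≈ₚ x
    ≈-refl {x} = span-ext (λ g → l-refl (x g)) span-zero
    ≈-sym : ∀ {x y} → x ≈ₚ y → y ≈ₚ x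
    ≈-sym {x} {y} p = span-ext (λ g → l-sym (x g) (y g)) (span-neg p)
    ≈-trans : ∀ {x y z} → x ≈ₚ y → y ≈ₚ z → x ≈ₚ z
    ≈-trans {x} {y} {z} p q = span-ext (λ g → l-trans (x g) (y g) (z g)) (span-add p q)
    fromEq : ∀ {x y} → (∀ g → x g ≡ y g) → x ≈ₚ y
    fromEq {x} {y} e = span-ext (λ g → P.cong (λ t → x g - t) (e g)) (≈-refl {x})

  group : AbelianGroup 0ℓ 0ℓ
  group = record
    { Carrier = Gen → ℤ
    ; _≈_ = _≈ₚ_
    ; _∙_ = λ x y g → x g ℤ.+ y g
    ; ε = λ _ → 0ℤ
    ; _⁻¹ = λ x g → - x g
    ; isAbelianGroup = record
      { isGroup = record
        { isMonoid = record
          { isSemigroup = record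
            { isMagma = record
              { isEquivalence = record { refl = λ {x} → ≈-refl {x} ; sym = λ {x} {y} → ≈-sym {x} {y} ; trans = λ {x} {y} {z} → ≈-trans {x} {y} {z} }
              ; ∙-cong = λ {x} {y} {u} {v} p q →
                  span-ext (λ g → l-add (x g) (y g) (u g) (v g)) (span-add p q) }
            ; assoc = λ x y z → fromEq (λ g → ℤP.+-assoc (x g) (y g) (z g)) }
          ; identity = (λ x → fromEq (λ g → ℤP.+-identityˡ (x g)))
                     , (λ x → fromEq (λ g → ℤP.+-identityʳ (x g))) }
        ; inverse = (λ x → fromEq (λ g → ℤP.+-inverseˡ (x g)))
                  , (λ x → fromEq (λ g → ℤP.+-inverseʳ (x g)))
        ; ⁻¹-cong = λ {x} {y} p → span-ext (λ g → l-neg (x g) (y g)) (span-neg p) }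
      ; comm = λ x y → fromEq (λ g → ℤP.+-comm (x g) (y g)) }
    }

-- Combinatorial encoding (faces glued along sides):
--   * R = Fin k, C = Fin nC, S = Fin nS  (V is their disjoint union);
--   * white triangles Fin nW, black triangles Fin nB; each triangle has
--     exactly one vertex in each of R, C, S (wR w, wC w, wS w), resp.
--     (bR b, bC b, bS b);
--   * every edge lies in exactly one white and one black triangle.  An
--     edge joins two colour classes, so the edges of type RC (resp. RS,
--     CS) are in bijection with the white triangles and with the black
--     triangles; eRC w is the black triangle on the other side of the
--     RC-side of the white triangle w (similarly eRS, eCS).  The glued
--     sides have the same endpoints (gRC, gRS, gCS).
--   * the result is a closed surface: around every vertex the triangles
--     containing it form a single cycle (link of a vertex is a circle),
--     every vertex lies in some triangle;
--   * the surface is connected (the dual graph is connected) and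
--     nonempty.
-- Orientability is automatic for such a colouring (orient white
-- triangles R→C→S and black triangles R→S→C).

-- rotation around a vertex: cross one edge of a white triangle into
-- a black triangle, then the other edge of that black triangle at the
-- same vertex back into the next white triangle
rot : ∀ {nW nB} → Fin nW ↔ Fin nB → Fin nW ↔ Fin nB → Fin nW → Fin nW
rot e₁ e₂ w = Inverse.from e₂ (Inverse.to e₁ w)

data Adjacent {nW nB} (e₁ e₂ e₃ : Fin nW ↔ Fin nB)
       : Fin nW ⊎ Fin nB → Fin nW ⊎ Fin nB → Set where
  adj₁ : ∀ w → Adjacent e₁ e₂ e₃ (inj₁ w) (inj₂ (Inverse.to e₁ w))
  adj₂ : ∀ w → Adjacent e₁ e₂ e₃ (inj₁ w) (inj₂ (Inverse.to e₂ w))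
  adj₃ : ∀ w → Adjacent e₁ e₂ e₃ (inj₁ w) (inj₂ (Inverse.to e₃ w))

record ColouredTriangulation : Set where
  field
    k nC nS nW nB : ℕ
    wR : Fin nW → Fin k
    wC : Fin nW → Fin nC
    wS : Fin nW → Fin nS
    bR : Fin nB → Fin k
    bC : Fin nB → Fin nC
    bS : Fin nB → Fin nS
    eRC eRS eCS : Fin nW ↔ Fin nB
    gRC : ∀ w → bR (Inverse.to eRC w) ≡ wR w × bC (Inverse.to eRC w) ≡ wC w
    gRS : ∀ w → bR (Inverse.to eRS w) ≡ wR w × bS (Inverse.to eRS w) ≡ wS w
    gCS : ∀ w → bC (Inverse.to eCS w) ≡ wC w × bS (Inverse.to eCS w) ≡ wS w
    nonempty  : 0 < nW
    connected : ∀ f g → EqClosure (Adjacent eRC eRS eCS) f g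
    -- every vertex lies in a triangle, and the triangles around it form
    -- a single cycle (around an R-vertex the edges crossed alternate
    -- between RC and RS, etc.)
    linkR : ∀ r → ∃[ w ] wR w ≡ r
    linkC : ∀ c → ∃[ w ] wC w ≡ c
    linkS : ∀ s → ∃[ w ] wS w ≡ s
    cycR  : ∀ w w′ → wR w ≡ wR w′ → ∃[ m ] iter (rot eRC eRS) m w ≡ w′
    cycC  : ∀ w w′ → wC w ≡ wC w′ → ∃[ m ] iter (rot eRC eCS) m w ≡ w′
    cycS  : ∀ w w′ → wS w ≡ wS w′ → ∃[ m ] iter (rot eRS eCS) m w ≡ w′

zeroRowSum : ∀ {k} → (Fin k → Fin k → ℕ) → Fin k → Fin k → ℤ
zeroRowSum off i j =
  if ⌊ i ≟ j ⌋
  then - sumℤ (λ j′ → if ⌊ i ≟ j′ ⌋ then 0ℤ else + off i j′)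
  else + off i j

module Groups (Δ : ColouredTriangulation) where
  open ColouredTriangulation Δ

  Vtx : Set
  Vtx = Fin k ⊎ Fin nC ⊎ Fin nS

  triRel : Fin k → Fin nC → Fin nS → Vtx → ℤ
  triRel r c s (inj₁ r′)        = δ r r′
  triRel r c s (inj₂ (inj₁ c′)) = δ c c′
  triRel r c s (inj₂ (inj₂ s′)) = δ s s′

  A-W A-B : AbelianGroup 0ℓ 0ℓ
  A-W = Presentation.group {Vtx} {Fin nW} (λ w → triRel (wR w) (wC w) (wS w))
  A-B = Presentation.group {Vtx} {Fin nB} (λ b → triRel (bR b) (bC b) (bS b))

  -- CS-edges are indexed by the white triangle w containing them; the
  -- black triangle containing that edge is Inverse.to eCS w.
  -- t i j (i ≠ j) : number of CS-edges whose white triangle has vertex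
  -- r_j and whose black triangle has vertex r_i
  T : Fin k → Fin k → ℤ
  T = zeroRowSum (λ i j →
        count (λ w → ⌊ wR w ≟ j ⌋ ∧ ⌊ bR (Inverse.to eCS w) ≟ i ⌋))

  T′ : Fin k → Fin k → ℤ
  T′ = zeroRowSum (λ i j →
        count (λ w → ⌊ bR (Inverse.to eCS w) ≟ j ⌋ ∧ ⌊ wR w ≟ i ⌋))

  B-W B-B : AbelianGroup 0ℓ 0ℓ
  B-W = Presentation.group {Fin k} {Fin k} T
  B-B = Presentation.group {Fin k} {Fin k} T′

  C-W : AbelianGroup 0ℓ 0ℓ
  C-W = Torsion.torsionSubgroup B-W

module Submission where

-- For a diagonal
-- presentation the torsion is explicit and finite; hence for a square M
-- the torsion is finite, and if the only solutions of M z = 0 are the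
-- constants then every vector with coordinate sum 0 is torsion.
--
-- For a triangulation, T is the Laplacian of the balanced multigraph on
-- R with one edge per CS-edge (black R-vertex → white R-vertex), and T′
-- that of the reversed multigraph, so T′ = Tᵀ and B-W ≅ B-B.  The
-- discrete maximum principle and connectedness show that T z = 0 forces
-- z constant, so C-W (the finite torsion of B-W) consists of the vectors
-- with coordinate sum 0.  The map x_j ↦ r_j sends C-W onto the common
-- kernel M of the functionals ΣR − ΣS and ΣC − ΣS on A-W, and these two
-- functionals split A-W ≅ ℤ ⊕ ℤ ⊕ M.  The black statement is the white
-- one for the triangulation with the colours interchanged.

open import Defs
open import Level using (0ℓ)
open import Data.Nat as ℕ using (ℕ; zero; suc; _<_; s≤s; z≤n)
import Data.Nat.Properties as ℕP
open import Data.Integer as ℤ using (ℤ; +_; 0ℤ; 1ℤ; -_; _-_; _+_; _*_; _≤_; NonZero; ≢-nonZero)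
import Data.Integer.Properties as ℤP
open import Data.Integer.DivMod using (_/_; _%_; n%d<d; a≡a%n+[a/n]*n)
open import Data.Integer.Tactic.RingSolver using (solve-∀)
open import Data.Fin using (Fin; zero; suc; _≟_; fromℕ<)
import Data.Fin.Permutation.Components as PermutationComponents
open import Data.Vec.Functional using () renaming (_∷_ to cons)
open import Data.Bool using (Bool; true; false; if_then_else_; _∧_)
open import Data.Empty using (⊥-elim)
open import Data.Product using (Σ; ∃; ∃-syntax; _×_; _,_; proj₁; proj₂)
open import Data.Sum using (_⊎_; inj₁; inj₂; swap)
open import Data.Sum.Properties using (swap-involutive)
open import Data.List using (List; []; _∷_; map; upTo; cartesianProductWith)
open import Data.List.Relation.Unary.Any using (Any; here; there)
import Data.List.Relation.Unary.Any as Any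
open import Data.List.Relation.Unary.Any.Properties using (map⁺; cartesianProductWith⁺)
open import Data.List.Membership.Propositional.Properties using (∈-upTo⁺)
open import Function using (_∘_; id)
open import Function.Bundles using (_↔_; Inverse)
open import Function.Construct.Symmetry using (↔-sym)
open import Relation.Nullary using (Dec; yes; no; ⌊_⌋)
open import Relation.Binary.PropositionalEquality
  using (_≡_; _≢_; refl; sym; trans; cong; cong₂; subst; subst₂; module ≡-Reasoning)
open import Relation.Binary.Construct.Closure.Equivalence
  using (EqClosure; gfold; return; symmetric; isEquivalence)
open import Relation.Binary.Construct.Closure.Symmetric using (fwd; bwd)
open import Relation.Binary.Construct.Closure.ReflexiveTransitive using (ε; _◅_)
open import Algebra.Bundles using (AbelianGroup)
open import Algebra.Morphism.Structures using (module GroupMorphisms)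
import Algebra.Properties.Group as GroupProperties
import Algebra.Properties.Monoid.Mult as Mult
import Algebra.Properties.CommutativeMonoid.Sum as CMSum

record Hom (G H : AbelianGroup 0ℓ 0ℓ) : Set where
  private
    module G = AbelianGroup G
    module H = AbelianGroup H
  field
    fun  : G.Carrier → H.Carrier
    fun-cong : ∀ {x y} → x G.≈ y → fun x H.≈ fun y
    homo : ∀ x y → fun (x G.∙ y) H.≈ (fun x H.∙ fun y)

record Iso (G H : AbelianGroup 0ℓ 0ℓ) : Set where
  private
    module G = AbelianGroup G
    module H = AbelianGroup H
  field
    to        : G.Carrier → H.Carrier
    from      : H.Carrier → G.Carrier
    to-cong   : ∀ {x y} → x G.≈ y → to x H.≈ to y
    from-cong : ∀ {x y} → x H.≈ y → from x G.≈ from y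
    to-homo   : ∀ x y → to (x G.∙ y) H.≈ (to x H.∙ to y)
    to-from   : ∀ y → to (from y) H.≈ y
    from-to   : ∀ x → from (to x) G.≈ x

module HomProperties {G H : AbelianGroup 0ℓ 0ℓ} (f : Hom G H) where
  private
    module G = AbelianGroup G
    module H = AbelianGroup H
  open Hom f
  open Mult G.monoid renaming (_×_ to _·ᴳ_) using ()
  open Mult H.monoid renaming (_×_ to _·ᴴ_) using ()

  ε-homo : fun G.ε H.≈ H.ε
  ε-homo = GroupProperties.identityˡ-unique H.group (fun G.ε) (fun G.ε)
    (H.trans (H.sym (homo G.ε G.ε)) (fun-cong (G.identityˡ G.ε)))

  ⁻¹-homo : ∀ x → fun (x G.⁻¹) H.≈ fun x H.⁻¹
  ⁻¹-homo x = GroupProperties.inverseˡ-unique H.group (fun (x G.⁻¹)) (fun x)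
    (H.trans (H.sym (homo (x G.⁻¹) x)) (H.trans (fun-cong (G.inverseˡ x)) ε-homo))

  ·-homo : ∀ n x → fun (n ·ᴳ x) H.≈ n ·ᴴ fun x
  ·-homo zero    x = ε-homo
  ·-homo (suc n) x = H.trans (homo x (n ·ᴳ x)) (H.∙-congˡ (·-homo n x))

  isGroupHomomorphism : GroupMorphisms.IsGroupHomomorphism G.rawGroup H.rawGroup fun
  isGroupHomomorphism = record
    { isMonoidHomomorphism = record
      { isMagmaHomomorphism = record
        { isRelHomomorphism = record { cong = fun-cong }
        ; homo = homo }
      ; ε-homo = ε-homo }
    ; ⁻¹-homo = ⁻¹-homo }

  preserves-torsion : ∀ {x} → Torsion.IsTorsion G x → Torsion.IsTorsion H (fun x)
  preserves-torsion {x} (n , p) = n , H.trans (H.sym (·-homo (suc n) x)) (H.trans (fun-cong p) ε-homo)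

  onTorsion : Hom (Torsion.torsionSubgroup G) (Torsion.torsionSubgroup H)
  onTorsion = record
    { fun  = λ t → fun (proj₁ t) , preserves-torsion (proj₂ t)
    ; fun-cong = fun-cong
    ; homo = λ s t → homo (proj₁ s) (proj₁ t) }

homComp : ∀ {G H K} → Hom G H → Hom H K → Hom G K
homComp {K = K} f g = record
  { fun  = λ x → Hom.fun g (Hom.fun f x)
  ; fun-cong = λ p → Hom.fun-cong g (Hom.fun-cong f p)
  ; homo = λ x y → AbelianGroup.trans K (Hom.fun-cong g (Hom.homo f x y)) (Hom.homo g _ _) }

module IsoProperties {G H : AbelianGroup 0ℓ 0ℓ} (f : Iso G H) where
  private
    module G = AbelianGroup G
    module H = AbelianGroup H
  open Iso f

  toHom : Hom G H
  toHom = record { fun = to ; fun-cong = to-cong ; homo = to-homo }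

  from-homo : ∀ x y → from (x H.∙ y) G.≈ (from x G.∙ from y)
  from-homo x y = G.trans (from-cong (H.∙-cong (H.sym (to-from x)) (H.sym (to-from y))))
                 (G.trans (from-cong (H.sym (to-homo (from x) (from y)))) (from-to _))

  fromHom : Hom H G
  fromHom = record { fun = from ; fun-cong = from-cong ; homo = from-homo }

  isoSym : Iso H G
  isoSym = record
    { to = from ; from = to ; to-cong = from-cong ; from-cong = to-cong
    ; to-homo = from-homo ; to-from = from-to ; from-to = to-from }

  iso⇒≅ : G ≅ H
  iso⇒≅ = to , record
    { isGroupMonomorphism = record
      { isGroupHomomorphism = HomProperties.isGroupHomomorphism toHom
      ; injective = λ {x} {y} p → G.trans (G.sym (from-to x)) (G.trans (from-cong p) (from-to y)) }
    ; surjective = λ y → from y , λ z≈ → H.trans (to-cong z≈) (to-from y) }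

  onTorsion : Iso (Torsion.torsionSubgroup G) (Torsion.torsionSubgroup H)
  onTorsion = record
    { to = Hom.fun (HomProperties.onTorsion toHom)
    ; from = Hom.fun (HomProperties.onTorsion fromHom)
    ; to-cong = to-cong ; from-cong = from-cong
    ; to-homo = λ s t → to-homo (proj₁ s) (proj₁ t)
    ; to-from = λ t → to-from (proj₁ t) ; from-to = λ s → from-to (proj₁ s) }

  finite-from : FiniteGroup H → FiniteGroup G
  finite-from (ys , cover) = map from ys , λ x → map⁺ (Any.map (represent x) (cover (to x)))
    where
    represent : ∀ x {y} → to x H.≈ y → x G.≈ from y
    represent x p = G.trans (G.sym (from-to x)) (from-cong p)

open IsoProperties using (isoSym; iso⇒≅)

isoTrans : ∀ {G H K} → Iso G H → Iso H K → Iso G K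
isoTrans {G} {H} {K} f g = record
  { to = λ x → g.to (f.to x) ; from = λ x → f.from (g.from x)
  ; to-cong = λ p → g.to-cong (f.to-cong p)
  ; from-cong = λ p → f.from-cong (g.from-cong p)
  ; to-homo = λ x y → K.trans (g.to-cong (f.to-homo x y)) (g.to-homo _ _)
  ; to-from = λ y → K.trans (g.to-cong (f.to-from _)) (g.to-from y)
  ; from-to = λ x → G.trans (f.from-cong (g.from-to _)) (f.from-to x) }
  where
  module f = Iso f
  module g = Iso g
  module G = AbelianGroup G
  module K = AbelianGroup K

surjection⇒quotient : ∀ {G K} (g : Hom G K) →
  (∀ y → ∃ λ x → AbelianGroup._≈_ K (Hom.fun g x) y) → IsQuotientOf G K
surjection⇒quotient {K = K} g surj = Hom.fun g , HomProperties.isGroupHomomorphism g ,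
  λ y → proj₁ (surj y) , λ z≈ → AbelianGroup.trans K (Hom.fun-cong g z≈) (proj₂ (surj y))

quotient-along-iso : ∀ {G H K} → Iso G H → IsQuotientOf H K → IsQuotientOf G K
quotient-along-iso {H = H} {K} f (g , g-hom , g-surj) =
  surjection⇒quotient (homComp (IsoProperties.toHom f) gH)
    λ y → Iso.from f (proj₁ (g-surj y)) ,
          proj₂ (g-surj y) (Iso.to-from f _)
  where
  module g-hom = GroupMorphisms.IsGroupHomomorphism g-hom
  gH : Hom H K
  gH = record { fun = g ; fun-cong = g-hom.⟦⟧-cong ; homo = g-hom.homo }

≟-refl : ∀ {n} (i : Fin n) → ⌊ i ≟ i ⌋ ≡ true
≟-refl i with i ≟ i
... | yes _   = refl
... | no i≢i = ⊥-elim (i≢i refl)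

≟-≢ : ∀ {n} {i j : Fin n} → i ≢ j → ⌊ i ≟ j ⌋ ≡ false
≟-≢ {i = i} {j} i≢j with i ≟ j
... | yes i≡j = ⊥-elim (i≢j i≡j)
... | no _    = refl

≟-sym : ∀ {n} (i j : Fin n) → ⌊ i ≟ j ⌋ ≡ ⌊ j ≟ i ⌋
≟-sym i j with i ≟ j
... | yes refl = sym (≟-refl i)
... | no i≢j   = sym (≟-≢ (λ j≡i → i≢j (sym j≡i)))

≟-suc : ∀ {n} (i j : Fin n) → ⌊ suc i ≟ suc j ⌋ ≡ ⌊ i ≟ j ⌋
≟-suc i j with i ≟ j
... | yes _ = refl
... | no _  = refl

sum-cong : ∀ {n} {f g : Fin n → ℤ} → (∀ i → f i ≡ g i) → sumℤ f ≡ sumℤ g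
sum-cong {zero}  e = refl
sum-cong {suc n} e = cong₂ _+_ (e zero) (sum-cong (e ∘ suc))

sum-zero : ∀ {n} {f : Fin n → ℤ} → (∀ i → f i ≡ 0ℤ) → sumℤ f ≡ 0ℤ
sum-zero {zero}  e = refl
sum-zero {suc n} e = trans (cong₂ _+_ (e zero) (sum-zero (e ∘ suc))) refl

sum-+ : ∀ {n} (f g : Fin n → ℤ) → sumℤ (λ i → f i + g i) ≡ sumℤ f + sumℤ g
sum-+ {zero}  f g = refl
sum-+ {suc n} f g = trans (cong (_+_ (f zero + g zero)) (sum-+ (f ∘ suc) (g ∘ suc)))
                          (interchange (f zero) (g zero) (sumℤ (f ∘ suc)) (sumℤ (g ∘ suc)))
  where
  interchange : ∀ a b c d → (a + b) + (c + d) ≡ (a + c) + (b + d)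
  interchange = solve-∀

sum-neg : ∀ {n} (f : Fin n → ℤ) → sumℤ (λ i → - f i) ≡ - sumℤ f
sum-neg {zero}  f = refl
sum-neg {suc n} f = trans (cong (_+_ (- f zero)) (sum-neg (f ∘ suc))) (sym (ℤP.neg-distrib-+ (f zero) _))

sum-- : ∀ {n} (f g : Fin n → ℤ) → sumℤ (λ i → f i - g i) ≡ sumℤ f - sumℤ g
sum-- f g = trans (sum-+ f (λ i → - g i)) (cong (_+_ (sumℤ f)) (sum-neg g))

sum-scalˡ : ∀ {n} (c : ℤ) (f : Fin n → ℤ) → sumℤ (λ i → c * f i) ≡ c * sumℤ f
sum-scalˡ {zero}  c f = sym (ℤP.*-zeroʳ c)
sum-scalˡ {suc n} c f = trans (cong (_+_ (c * f zero)) (sum-scalˡ c (f ∘ suc))) (sym (ℤP.*-distribˡ-+ c _ _))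

sum-scalʳ : ∀ {n} (c : ℤ) (f : Fin n → ℤ) → sumℤ (λ i → f i * c) ≡ sumℤ f * c
sum-scalʳ c f = trans (sum-cong (λ i → ℤP.*-comm (f i) c)) (trans (sum-scalˡ c f) (ℤP.*-comm c _))

sum-swap : ∀ {m n} (f : Fin m → Fin n → ℤ) →
           sumℤ (λ i → sumℤ (λ j → f i j)) ≡ sumℤ (λ j → sumℤ (λ i → f i j))
sum-swap {zero} {n} f = sym (sum-zero {n} (λ _ → refl))
sum-swap {suc m} f = trans (cong (_+_ (sumℤ (f zero))) (sum-swap (f ∘ suc)))
                           (sym (sum-+ (f zero) (λ j → sumℤ (λ i → f (suc i) j))))

sum-reindex : ∀ {m n} (e : Fin m ↔ Fin n) (f : Fin n → ℤ) →
              sumℤ (λ w → f (Inverse.to e w)) ≡ sumℤ f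
sum-reindex e f = trans (sumℤ≡sum (λ w → f (Inverse.to e w))) (trans (sym (Sum.sum-permute f e)) (sym (sumℤ≡sum f)))
  where
  module Sum = CMSum ℤP.+-0-commutativeMonoid
  sumℤ≡sum : ∀ {n} (g : Fin n → ℤ) → sumℤ g ≡ Sum.sum g
  sumℤ≡sum {zero}  g = refl
  sumℤ≡sum {suc n} g = cong (_+_ (g zero)) (sumℤ≡sum (g ∘ suc))

sum-pick : ∀ {n} (a : Fin n) (f : Fin n → ℤ) →
           sumℤ (λ j → if ⌊ a ≟ j ⌋ then f j else 0ℤ) ≡ f a
sum-pick {suc n} zero    f = trans (cong (_+_ (f zero)) (sum-zero {n} (λ _ → refl))) (ℤP.+-identityʳ (f zero))
sum-pick {suc n} (suc a) f = trans (ℤP.+-identityˡ _)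
  (trans (sum-cong (λ j → cong (λ b → if b then f (suc j) else 0ℤ) (≟-suc a j))) (sum-pick a (f ∘ suc)))

δ-diag : ∀ {n} (i : Fin n) → δ i i ≡ 1ℤ
δ-diag i = cong (λ b → if b then 1ℤ else 0ℤ) (≟-refl i)

δ-sym : ∀ {n} (i j : Fin n) → δ i j ≡ δ j i
δ-sym i j = cong (λ b → if b then 1ℤ else 0ℤ) (≟-sym i j)

δ-* : ∀ {n} (i j : Fin n) (x : ℤ) → δ i j * x ≡ (if ⌊ i ≟ j ⌋ then x else 0ℤ)
δ-* i j x with ⌊ i ≟ j ⌋
... | true  = ℤP.*-identityˡ x
... | false = refl

sum-δ-*ˡ : ∀ {n} (a : Fin n) (f : Fin n → ℤ) → sumℤ (λ j → δ a j * f j) ≡ f a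
sum-δ-*ˡ a f = trans (sum-cong (λ j → δ-* a j (f j))) (sum-pick a f)

sum-δ-*ʳ : ∀ {n} (a : Fin n) (f : Fin n → ℤ) → sumℤ (λ j → f j * δ j a) ≡ f a
sum-δ-*ʳ a f = trans (sum-cong (λ j → trans (ℤP.*-comm (f j) (δ j a)) (cong (_* f j) (δ-sym j a))))
                     (sum-δ-*ˡ a f)

sum-δ : ∀ {n} (a : Fin n) → sumℤ (δ a) ≡ 1ℤ
sum-δ a = sum-pick a (λ _ → 1ℤ)

sum-omit : ∀ {k} (i : Fin k) (x : Fin k → ℤ) →
           sumℤ (λ j → if ⌊ i ≟ j ⌋ then 0ℤ else x j) ≡ sumℤ x - x i
sum-omit i x = begin
  sumℤ omitted                                  ≡⟨ add-sub (sumℤ omitted) (x i) ⟩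
  (sumℤ omitted + x i) - x i                    ≡⟨ cong (λ t → sumℤ omitted + t - x i) (sum-pick i x) ⟨
  (sumℤ omitted + sumℤ picked) - x i            ≡⟨ cong (_- x i) (sum-+ omitted picked) ⟨
  sumℤ (λ j → omitted j + picked j) - x i       ≡⟨ cong (_- x i) (sum-cong split) ⟩
  sumℤ x - x i                                  ∎
  where
  open ≡-Reasoning
  omitted picked : _ → ℤ
  omitted j = if ⌊ i ≟ j ⌋ then 0ℤ else x j
  picked  j = if ⌊ i ≟ j ⌋ then x j else 0ℤ
  split : ∀ j → omitted j + picked j ≡ x j
  split j with ⌊ i ≟ j ⌋
  ... | true  = ℤP.+-identityˡ (x j)
  ... | false = ℤP.+-identityʳ (x j)
  add-sub : ∀ a b → a ≡ (a + b) - b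
  add-sub = solve-∀

suc-* : ∀ n z → + suc n * z ≡ z + + n * z
suc-* n z = trans (cong (_* z) (ℤP.pos-+ 1 n)) (trans (ℤP.*-distribʳ-+ z 1ℤ (+ n)) (cong (λ t → t + + n * z) (ℤP.*-identityˡ z)))

count≡sum : ∀ {n} (p : Fin n → Bool) → + count p ≡ sumℤ (λ w → if p w then 1ℤ else 0ℤ)
count≡sum {zero}  p = refl
count≡sum {suc n} p with p zero
... | true  = trans (ℤP.pos-+ 1 (count (p ∘ suc))) (cong (_+_ 1ℤ) (count≡sum (p ∘ suc)))
... | false = trans (sym (ℤP.+-identityˡ _)) (cong (_+_ 0ℤ) (count≡sum (p ∘ suc)))

module ℤ+ = GroupProperties (AbelianGroup.group ℤ-group)

record LinearFunctional {A : Set} (h : (A → ℤ) → ℤ) : Set where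
  field
    ext : ∀ {x y} → (∀ a → x a ≡ y a) → h x ≡ h y
    add : ∀ x y → h (λ a → x a + y a) ≡ h x + h y

  zer : h (λ _ → 0ℤ) ≡ 0ℤ
  zer = ℤ+.identityˡ-unique (h (λ _ → 0ℤ)) (h (λ _ → 0ℤ))
          (sym (trans (ext (λ _ → refl)) (add (λ _ → 0ℤ) (λ _ → 0ℤ))))

  neg : ∀ x → h (λ a → - x a) ≡ - h x
  neg x = ℤ+.inverseʳ-unique (h x) _ (trans (sym (add x (λ a → - x a))) (trans (ext (λ a → ℤP.+-inverseʳ (x a))) zer))

  nat : ∀ n x → h (λ a → + n * x a) ≡ + n * h x
  nat zero    x = trans (ext (λ a → ℤP.*-zeroˡ (x a))) (trans zer (sym (ℤP.*-zeroˡ (h x))))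
  nat (suc n) x = begin
    h (λ a → + suc n * x a)      ≡⟨ ext (λ a → suc-* n (x a)) ⟩
    h (λ a → x a + + n * x a)    ≡⟨ add x (λ a → + n * x a) ⟩
    h x + h (λ a → + n * x a)    ≡⟨ cong (_+_ (h x)) (nat n x) ⟩
    h x + + n * h x              ≡⟨ suc-* n (h x) ⟨
    + suc n * h x                ∎
    where open ≡-Reasoning

  scal : ∀ c x → h (λ a → c * x a) ≡ c * h x
  scal (+ n)      x = nat n x
  scal ℤ.-[1+ n ] x = trans (ext (λ a → sym (ℤP.neg-distribˡ-* (+ suc n) (x a))))
    (trans (neg (λ a → + suc n * x a)) (trans (cong -_ (nat (suc n) x)) (ℤP.neg-distribˡ-* (+ suc n) (h x))))

  sum : ∀ {m} (f : Fin m → A → ℤ) → h (λ a → sumℤ (λ i → f i a)) ≡ sumℤ (λ i → h (f i))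
  sum {zero}  f = zer
  sum {suc m} f = trans (add (f zero) (λ a → sumℤ (λ i → f (suc i) a))) (cong (_+_ (h (f zero))) (sum (f ∘ suc)))

representation : ∀ {k} {h : (Fin k → ℤ) → ℤ} → LinearFunctional h →
                 ∀ y → h y ≡ sumℤ (λ j → y j * h (δ j))
representation {h = h} lin y = trans (ext (λ g → sym (sum-δ-*ʳ g y)))
  (trans (sum (λ j g → y j * δ j g)) (sum-cong (λ j → scal (y j) (δ j))))
  where open LinearFunctional lin

sum-linear : ∀ {n} → LinearFunctional {Fin n} sumℤ
sum-linear = record { ext = sum-cong ; add = sum-+ }

precompose : ∀ {A B : Set} (f : B → A) {h : (B → ℤ) → ℤ} →
             LinearFunctional h → LinearFunctional {A} (λ x → h (x ∘ f))
precompose f lin = record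
  { ext = λ e → LinearFunctional.ext lin (e ∘ f)
  ; add = λ x y → LinearFunctional.add lin (x ∘ f) (y ∘ f) }

difference : ∀ {A : Set} {h h′ : (A → ℤ) → ℤ} →
             LinearFunctional h → LinearFunctional h′ → LinearFunctional (λ x → h x - h′ x)
difference {h = h} {h′} l l′ = record
  { ext = λ e → cong₂ _-_ (LinearFunctional.ext l e) (LinearFunctional.ext l′ e)
  ; add = λ x y → trans (cong₂ _-_ (LinearFunctional.add l x y) (LinearFunctional.add l′ x y))
                        (regroup (h x) (h y) (h′ x) (h′ y)) }
  where
  regroup : ∀ a b c d → (a + b) - (c + d) ≡ (a - c) + (b - d)
  regroup = solve-∀

Linear : ∀ {A B : Set} → ((A → ℤ) → (B → ℤ)) → Set
Linear L = ∀ b → LinearFunctional (λ x → L x b)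

module Pres {Gen Rel : Set} (rel : Rel → Gen → ℤ) where
  open Presentation rel public

  span-sub : ∀ {x y} → Span x → Span y → Span (λ g → x g - y g)
  span-sub p q = span-add p (span-neg q)

  span-nat : ∀ {x} n → Span x → Span (λ g → + n * x g)
  span-nat {x} zero    p = span-ext (λ g → sym (ℤP.*-zeroˡ (x g))) span-zero
  span-nat {x} (suc n) p = span-ext (λ g → sym (suc-* n (x g))) (span-add p (span-nat n p))

  span-scal : ∀ {x} c → Span x → Span (λ g → c * x g)
  span-scal (+ n)      p = span-nat n p
  span-scal {x} ℤ.-[1+ n ] p =
    span-ext (λ g → ℤP.neg-distribˡ-* (+ suc n) (x g)) (span-neg (span-nat (suc n) p))

  span-combination : ∀ {m} (u : Fin m → ℤ) (f : Fin m → Gen → ℤ) →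
                     (∀ i → Span (f i)) → Span (λ g → sumℤ (λ i → u i * f i g))
  span-combination {zero}  u f p = span-zero
  span-combination {suc m} u f p =
    span-add (span-scal (u zero) (p zero)) (span-combination (u ∘ suc) (f ∘ suc) (p ∘ suc))

  fromEq : ∀ {x y} → (∀ g → x g ≡ y g) → x ≈ₚ y
  fromEq {x} e = span-ext (λ g → trans (sym (ℤP.+-inverseʳ (x g))) (cong (_-_ (x g)) (e g))) span-zero

  span⇒≈0 : ∀ {x} → Span x → x ≈ₚ (λ _ → 0ℤ)
  span⇒≈0 {x} = span-ext (λ g → sym (ℤP.+-identityʳ (x g)))

  open Mult (AbelianGroup.monoid group) renaming (_×_ to _·_) using ()
  ·-pointwise : ∀ n x g → (n · x) g ≡ + n * x g
  ·-pointwise zero    x g = sym (ℤP.*-zeroˡ (x g))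
  ·-pointwise (suc n) x g = trans (cong (_+_ (x g)) (·-pointwise n x g)) (sym (suc-* n (x g)))

  -- a linear functional killing the relators kills the whole span, so
  -- it is well defined on the presented group
  module _ {h : (Gen → ℤ) → ℤ} (lin : LinearFunctional h) (kills : ∀ i → h (rel i) ≡ 0ℤ) where
    open LinearFunctional lin

    functional-span : ∀ {x} → Span x → h x ≡ 0ℤ
    functional-span (span-rel i)   = kills i
    functional-span span-zero      = zer
    functional-span (span-add p q) = trans (add _ _) (cong₂ _+_ (functional-span p) (functional-span q))
    functional-span (span-neg p)   = trans (neg _) (cong -_ (functional-span p))
    functional-span (span-ext e p) = trans (sym (ext e)) (functional-span p)

    functional-cong : ∀ {x y} → x ≈ₚ y → h x ≡ h y
    functional-cong {x} {y} p = ℤP.i-j≡0⇒i≡j (h x) (h y)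
      (trans (sym (trans (add x (λ a → - y a)) (cong (_+_ (h x)) (neg y)))) (functional-span p))

module _ {GA RA GB RB : Set} {relA : RA → GA → ℤ} {relB : RB → GB → ℤ} where
  private
    module A = Pres relA
    module B = Pres relB

  linear-span : ∀ {L} → Linear L → (∀ i → B.Span (L (relA i))) → ∀ {x} → A.Span x → B.Span (L x)
  linear-span lin h (A.span-rel i)   = h i
  linear-span lin h A.span-zero      = B.span-ext (λ b → sym (LinearFunctional.zer (lin b))) B.span-zero
  linear-span lin h (A.span-add p q) = B.span-ext (λ b → sym (LinearFunctional.add (lin b) _ _))
                                         (B.span-add (linear-span lin h p) (linear-span lin h q))
  linear-span lin h (A.span-neg p)   = B.span-ext (λ b → sym (LinearFunctional.neg (lin b) _))
                                         (B.span-neg (linear-span lin h p))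
  linear-span lin h (A.span-ext e p) = B.span-ext (λ b → LinearFunctional.ext (lin b) e) (linear-span lin h p)

  linear-hom : ∀ {L} → Linear L → (∀ i → B.Span (L (relA i))) → Hom A.group B.group
  linear-hom {L} lin h = record
    { fun      = L
    ; fun-cong = λ {x} {y} p → B.span-ext (λ b → L-difference x y b) (linear-span lin h p)
    ; homo     = λ x y → B.fromEq (λ b → LinearFunctional.add (lin b) x y) }
    where
    L-difference : ∀ x y b → L (λ g → x g - y g) b ≡ L x b - L y b
    L-difference x y b = trans (LinearFunctional.add (lin b) x _) (cong (_+_ (L x b)) (LinearFunctional.neg (lin b) y))

linear-iso : ∀ {GA RA GB RB : Set} {relA : RA → GA → ℤ} {relB : RB → GB → ℤ} {L L′} →
             Linear L → Linear L′ →
             (∀ i → Pres.Span relB (L (relA i))) → (∀ i → Pres.Span relA (L′ (relB i))) →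
             (∀ x a → L′ (L x) a ≡ x a) → (∀ y b → L (L′ y) b ≡ y b) →
             Iso (Pres.group relA) (Pres.group relB)
linear-iso {relA = relA} {relB} {L} {L′} lin lin′ h h′ inv inv′ = record
  { to = L ; from = L′
  ; to-cong = Hom.fun-cong (linear-hom lin h)
  ; from-cong = Hom.fun-cong (linear-hom lin′ h′)
  ; to-homo = Hom.homo (linear-hom lin h)
  ; to-from = λ y → Pres.fromEq relB (inv′ y)
  ; from-to = λ x → Pres.fromEq relA (inv x) }

identity-linear : ∀ {A : Set} → Linear {A} {A} id
identity-linear a = record { ext = λ e → e a ; add = λ _ _ → refl }

span-iso : ∀ {G RA RB : Set} (relA : RA → G → ℤ) (relB : RB → G → ℤ) →
           (∀ i → Pres.Span relB (relA i)) → (∀ i → Pres.Span relA (relB i)) →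
           Iso (Pres.group relA) (Pres.group relB)
span-iso relA relB h h′ = linear-iso identity-linear identity-linear h h′ (λ _ _ → refl) (λ _ _ → refl)

ext-iso : ∀ {G R : Set} (relA relB : R → G → ℤ) → (∀ i g → relA i g ≡ relB i g) →
          Iso (Pres.group relA) (Pres.group relB)
ext-iso relA relB e = span-iso relA relB
  (λ i → B.span-ext (λ g → sym (e i g)) (B.span-rel i))
  (λ i → A.span-ext (e i) (A.span-rel i))
  where
  module A = Pres relA
  module B = Pres relB

-- Cok M is the group with one generator per column
-- and one relator per row; M ∼ N says that M and N, and also their
-- transposes, present isomorphic groups.  Elementary row and column
-- operations preserve ∼, which is what lets us diagonalize.

Mat : ℕ → ℕ → Set
Mat m n = Fin m → Fin n → ℤ

Cok : ∀ {m n} → Mat m n → AbelianGroup 0ℓ 0ℓ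
Cok M = Pres.group M

_ᵀ : ∀ {m n} → Mat m n → Mat n m
(M ᵀ) j i = M i j

_∼_ : ∀ {m n m′ n′} → Mat m n → Mat m′ n′ → Set
M ∼ N = Iso (Cok M) (Cok N) × Iso (Cok (M ᵀ)) (Cok (N ᵀ))

∼-trans : ∀ {m n m′ n′ m″ n″} {M : Mat m n} {N : Mat m′ n′} {K : Mat m″ n″} →
          M ∼ N → N ∼ K → M ∼ K
∼-trans (f , g) (f′ , g′) = isoTrans f f′ , isoTrans g g′

∼-transpose : ∀ {m n m′ n′} {M : Mat m n} {N : Mat m′ n′} → M ∼ N → (M ᵀ) ∼ (N ᵀ)
∼-transpose (f , g) = g , f

∼-ext : ∀ {m n} {M N : Mat m n} → (∀ i j → M i j ≡ N i j) → M ∼ N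
∼-ext {M = M} {N} e = ext-iso M N e , ext-iso (M ᵀ) (N ᵀ) (λ j i → e i j)

shear : ∀ {m} → (Fin m → ℤ) → (Fin (suc m) → ℤ) → Fin (suc m) → ℤ
shear q x zero    = x zero
shear q x (suc i) = x (suc i) + q i * x zero

shear-linear : ∀ {m} (q : Fin m → ℤ) → Linear (shear q)
shear-linear q zero    = record { ext = λ e → e zero ; add = λ _ _ → refl }
shear-linear q (suc i) = record
  { ext = λ e → cong₂ (λ a b → a + q i * b) (e (suc i)) (e zero)
  ; add = λ x y → distribute (x (suc i)) (y (suc i)) (q i) (x zero) (y zero) }
  where
  distribute : ∀ a b c u v → (a + b) + c * (u + v) ≡ (a + c * u) + (b + c * v)
  distribute = solve-∀

shear-inverseˡ : ∀ {m} (q : Fin m → ℤ) x i → shear (λ j → - q j) (shear q x) i ≡ x i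
shear-inverseˡ q x zero    = refl
shear-inverseˡ q x (suc i) = cancel (x (suc i)) (q i) (x zero)
  where
  cancel : ∀ a c u → (a + c * u) + (- c) * u ≡ a
  cancel = solve-∀

shear-inverseʳ : ∀ {m} (q : Fin m → ℤ) x i → shear q (shear (λ j → - q j) x) i ≡ x i
shear-inverseʳ q x zero    = refl
shear-inverseʳ q x (suc i) = cancel (x (suc i)) (q i) (x zero)
  where
  cancel : ∀ a c u → (a + (- c) * u) + c * u ≡ a
  cancel = solve-∀

rowShear : ∀ {m n} → (Fin m → ℤ) → Mat (suc m) n → Mat (suc m) n
rowShear q M i j = shear q (λ i′ → M i′ j) i

rowShear-∼ : ∀ {m n} (q : Fin m → ℤ) (M : Mat (suc m) n) → M ∼ rowShear q M
rowShear-∼ {m} q M =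
  span-iso M S rows-of-M rows-of-S ,
  linear-iso (shear-linear q) (shear-linear (λ j → - q j))
    (λ j → ST.span-rel j)
    (λ j → MT.span-ext (λ i → sym (shear-inverseˡ q (λ i′ → M i′ j) i)) (MT.span-rel j))
    (shear-inverseˡ q) (shear-inverseʳ q)
  where
  S = rowShear q M
  module Mp = Pres M
  module Sp = Pres S
  module MT = Pres (M ᵀ)
  module ST = Pres (S ᵀ)
  rows-of-M : ∀ i → Sp.Span (M i)
  rows-of-M zero    = Sp.span-rel zero
  rows-of-M (suc i) = Sp.span-ext (λ j → shear-inverseˡ q (λ i′ → M i′ j) (suc i))
                        (Sp.span-add (Sp.span-rel (suc i)) (Sp.span-scal (- q i) (Sp.span-rel zero)))
  rows-of-S : ∀ i → Mp.Span (S i)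
  rows-of-S zero    = Mp.span-rel zero
  rows-of-S (suc i) = Mp.span-add (Mp.span-rel (suc i)) (Mp.span-scal (q i) (Mp.span-rel zero))

colShear : ∀ {m n} → (Fin n → ℤ) → Mat m (suc n) → Mat m (suc n)
colShear q M = rowShear q (M ᵀ) ᵀ

colShear-∼ : ∀ {m n} (q : Fin n → ℤ) (M : Mat m (suc n)) → M ∼ colShear q M
colShear-∼ q M = ∼-transpose (rowShear-∼ q (M ᵀ))

permuteRows : ∀ {m n} → (Fin m → Fin m) → Mat m n → Mat m n
permuteRows σ M i j = M (σ i) j

permuteRows-∼ : ∀ {m n} (σ σ′ : Fin m → Fin m) → (∀ i → σ (σ′ i) ≡ i) → (∀ i → σ′ (σ i) ≡ i) →
                (M : Mat m n) → M ∼ permuteRows σ M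
permuteRows-∼ σ σ′ σσ′ σ′σ M =
  span-iso M P (λ i → Pp.span-ext (λ j → cong (λ t → M t j) (σσ′ i)) (Pp.span-rel (σ′ i)))
               (λ i → Mp.span-rel (σ i)) ,
  linear-iso (permute-linear σ) (permute-linear σ′)
    (λ j → PT.span-rel j)
    (λ j → MT.span-ext (λ i → sym (cong (λ t → M t j) (σσ′ i))) (MT.span-rel j))
    (λ x i → cong x (σσ′ i)) (λ x i → cong x (σ′σ i))
  where
  P = permuteRows σ M
  module Mp = Pres M
  module Pp = Pres P
  module MT = Pres (M ᵀ)
  module PT = Pres (P ᵀ)
  permute-linear : (τ : Fin _ → Fin _) → Linear (λ (x : Fin _ → ℤ) i → x (τ i))
  permute-linear τ i = record { ext = λ e → e (τ i) ; add = λ _ _ → refl }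

swapRows : ∀ {m n} → Fin (suc m) → Mat (suc m) n → Mat (suc m) n
swapRows p = permuteRows (PermutationComponents.transpose zero p)

swapRows-∼ : ∀ {m n} (p : Fin (suc m)) (M : Mat (suc m) n) → M ∼ swapRows p M
swapRows-∼ p = permuteRows-∼ (PermutationComponents.transpose zero p) (PermutationComponents.transpose p zero)
  (λ _ → PermutationComponents.transpose-inverse zero p) (λ _ → PermutationComponents.transpose-inverse p zero)

swapCols : ∀ {m n} → Fin (suc n) → Mat m (suc n) → Mat m (suc n)
swapCols p M = swapRows p (M ᵀ) ᵀ

swapCols-∼ : ∀ {m n} (p : Fin (suc n)) (M : Mat m (suc n)) → M ∼ swapCols p M
swapCols-∼ p M = ∼-transpose (swapRows-∼ p (M ᵀ))

block : ∀ {m n} → ℤ → Mat m n → Mat (suc m) (suc n)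
block a M zero    = cons a (λ _ → 0ℤ)
block a M (suc i) = cons 0ℤ (M i)

block-ᵀ : ∀ {m n} (a : ℤ) (M : Mat m n) → ∀ i j → (block a M ᵀ) i j ≡ block a (M ᵀ) i j
block-ᵀ a M zero    zero    = refl
block-ᵀ a M zero    (suc j) = refl
block-ᵀ a M (suc i) zero    = refl
block-ᵀ a M (suc i) (suc j) = refl

module BlockSpan {m n} (a : ℤ) (M : Mat m n) where
  private
    module Mp = Pres M
    module Bp = Pres (block a M)

  split : ∀ {x} → Bp.Span x → (∃ λ c → x zero ≡ c * a) × Mp.Span (x ∘ suc)
  split (Bp.span-rel zero)    = (1ℤ , sym (ℤP.*-identityˡ a)) , Mp.span-zero
  split (Bp.span-rel (suc i)) = (0ℤ , sym (ℤP.*-zeroˡ a)) , Mp.span-rel i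
  split Bp.span-zero          = (0ℤ , sym (ℤP.*-zeroˡ a)) , Mp.span-zero
  split (Bp.span-add p q) with split p | split q
  ... | (c , e) , s | (c′ , e′) , s′ =
    (c + c′ , trans (cong₂ _+_ e e′) (sym (ℤP.*-distribʳ-+ a c c′))) , Mp.span-add s s′
  split (Bp.span-neg p) with split p
  ... | (c , e) , s = (- c , trans (cong -_ e) (ℤP.neg-distribˡ-* c a)) , Mp.span-neg s
  split (Bp.span-ext e p) with split p
  ... | (c , e′) , s = (c , trans (sym (e zero)) e′) , Mp.span-ext (e ∘ suc) s

  private
    embed : ∀ {y} → Mp.Span y → Bp.Span (cons 0ℤ y)
    embed (Mp.span-rel i)   = Bp.span-rel (suc i)
    embed Mp.span-zero      = Bp.span-ext (λ { zero → refl ; (suc j) → refl }) Bp.span-zero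
    embed (Mp.span-add p q) = Bp.span-ext (λ { zero → refl ; (suc j) → refl }) (Bp.span-add (embed p) (embed q))
    embed (Mp.span-neg p)   = Bp.span-ext (λ { zero → refl ; (suc j) → refl }) (Bp.span-neg (embed p))
    embed (Mp.span-ext e p) = Bp.span-ext (λ { zero → refl ; (suc j) → e j }) (embed p)

  combine : ∀ {x} c → x zero ≡ c * a → Mp.Span (x ∘ suc) → Bp.Span x
  combine {x} c e s = Bp.span-ext pointwise (Bp.span-add (Bp.span-scal c (Bp.span-rel zero)) (embed s))
    where
    pointwise : ∀ g → c * block a M zero g + cons 0ℤ (x ∘ suc) g ≡ x g
    pointwise zero    = trans (ℤP.+-identityʳ (c * a)) (sym e)
    pointwise (suc j) = trans (cong (_+ x (suc j)) (ℤP.*-zeroʳ c)) (ℤP.+-identityˡ (x (suc j)))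

module _ {m n m′ n′} (a : ℤ) {M : Mat m n} {N : Mat m′ n′} where
  private
    module BM = BlockSpan a M
    module BN = BlockSpan a N
    module CM = AbelianGroup (Cok M)
    module CN = AbelianGroup (Cok N)
    module BMG = AbelianGroup (Cok (block a M))
    module BNG = AbelianGroup (Cok (block a N))

  extend-cong : (f : (Fin n → ℤ) → (Fin n′ → ℤ)) → (∀ {x y} → x CM.≈ y → f x CN.≈ f y) →
                ∀ {x y} → x BMG.≈ y → cons (x zero) (f (x ∘ suc)) BNG.≈ cons (y zero) (f (y ∘ suc))
  extend-cong f f-cong p with BM.split p
  ... | (c , e) , s = BN.combine c e (f-cong s)

  same-corner : ∀ (x y : Fin (suc n′) → ℤ) → x zero ≡ y zero → (x ∘ suc) CN.≈ (y ∘ suc) → x BNG.≈ y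
  same-corner x y e s =
    BN.combine 0ℤ (trans (cong (_-_ (x zero)) (sym e)) (trans (ℤP.+-inverseʳ (x zero)) (sym (ℤP.*-zeroˡ a)))) s

block-iso : ∀ {m n m′ n′} (a : ℤ) {M : Mat m n} {N : Mat m′ n′} →
            Iso (Cok M) (Cok N) → Iso (Cok (block a M)) (Cok (block a N))
block-iso a {M} {N} F = record
  { to = λ x → cons (x zero) (F.to (x ∘ suc))
  ; from = λ y → cons (y zero) (F.from (y ∘ suc))
  ; to-cong = λ {x} {y} → extend-cong a {M} {N} F.to F.to-cong {x} {y}
  ; from-cong = λ {x} {y} → extend-cong a {N} {M} F.from F.from-cong {x} {y}
  ; to-homo = λ x y → same-corner a {M} {N}
      (cons (x zero + y zero) (F.to (λ j → x (suc j) + y (suc j))))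
      (λ g → cons (x zero) (F.to (x ∘ suc)) g + cons (y zero) (F.to (y ∘ suc)) g)
      refl (F.to-homo (x ∘ suc) (y ∘ suc))
  ; to-from = λ y → same-corner a {M} {N} (cons (y zero) (F.to (F.from (y ∘ suc)))) y
      refl (F.to-from (y ∘ suc))
  ; from-to = λ x → same-corner a {N} {M} (cons (x zero) (F.from (F.to (x ∘ suc)))) x
      refl (F.from-to (x ∘ suc)) }
  where module F = Iso F

block-∼ : ∀ {m n m′ n′} (a : ℤ) {M : Mat m n} {N : Mat m′ n′} → M ∼ N → block a M ∼ block a N
block-∼ a {M} {N} (f , g) = block-iso a f ,
  isoTrans (ext-iso (block a M ᵀ) (block a (M ᵀ)) (block-ᵀ a M))
    (isoTrans (block-iso a g) (ext-iso (block a (N ᵀ)) (block a N ᵀ) (λ i j → sym (block-ᵀ a N i j))))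

diag : ∀ {n} → (Fin n → ℤ) → Mat n n
diag {zero}  d ()
diag {suc n} d = block (d zero) (diag (d ∘ suc))

diag-ᵀ : ∀ {n} (d : Fin n → ℤ) → ∀ i j → (diag d ᵀ) i j ≡ diag d i j
diag-ᵀ {suc n} d zero    zero    = refl
diag-ᵀ {suc n} d zero    (suc j) = refl
diag-ᵀ {suc n} d (suc i) zero    = refl
diag-ᵀ {suc n} d (suc i) (suc j) = diag-ᵀ (d ∘ suc) i j

-- Diagonalization over ℤ: every square matrix is ∼ to a diagonal one.

Reduced : ∀ {n} → Mat (suc n) (suc n) → Set
Reduced {n} M = Σ ℤ λ a → Σ (Mat n n) λ M′ → M ∼ block a M′

reduced-∼ : ∀ {n} {M N : Mat (suc n) (suc n)} → M ∼ N → Reduced N → Reduced M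
reduced-∼ M∼N (a , M′ , N∼blk) = a , M′ , ∼-trans M∼N N∼blk

findNonzero : ∀ {n} (f : Fin n → ℤ) → (∃ λ i → f i ≢ 0ℤ) ⊎ (∀ i → f i ≡ 0ℤ)
findNonzero {zero}  f = inj₂ λ ()
findNonzero {suc n} f with f zero ℤ.≟ 0ℤ | findNonzero (f ∘ suc)
... | no f₀≢0 | _              = inj₁ (zero , f₀≢0)
... | yes _   | inj₁ (i , fᵢ≢0) = inj₁ (suc i , fᵢ≢0)
... | yes f₀≡0 | inj₂ rest     = inj₂ λ { zero → f₀≡0 ; (suc i) → rest i }

data CornerView {n} (M : Mat (suc n) (suc n)) : Set where
  cleared   : (∀ i → M (suc i) zero ≡ 0ℤ) → (∀ j → M zero (suc j) ≡ 0ℤ) → CornerView M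
  in-column : ∀ i → M (suc i) zero ≢ 0ℤ → CornerView M
  in-row    : ∀ j → M zero (suc j) ≢ 0ℤ → CornerView M

cornerView : ∀ {n} (M : Mat (suc n) (suc n)) → CornerView M
cornerView M with findNonzero (λ i → M (suc i) zero) | findNonzero (λ j → M zero (suc j))
... | inj₁ (i , ne) | _             = in-column i ne
... | inj₂ col      | inj₁ (j , ne) = in-row j ne
... | inj₂ col      | inj₂ row      = cleared col row

cleared-reduced : ∀ {n} (M : Mat (suc n) (suc n)) →
                  (∀ i → M (suc i) zero ≡ 0ℤ) → (∀ j → M zero (suc j) ≡ 0ℤ) → Reduced M
cleared-reduced M col row = M zero zero , (λ i j → M (suc i) (suc j)) , ∼-ext entries
  where
  entries : ∀ i j → M i j ≡ block (M zero zero) (λ i j → M (suc i) (suc j)) i j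
  entries zero    zero    = refl
  entries zero    (suc j) = row j
  entries (suc i) zero    = col i
  entries (suc i) (suc j) = refl

x-[x/a]a≡x%a : ∀ x a .{{_ : NonZero a}} → x + - (x / a) * a ≡ + (x % a)
x-[x/a]a≡x%a x a = trans (cong (λ t → t + - (x / a) * a) (a≡a%n+[a/n]*n x a)) (cancel (+ (x % a)) (x / a) a)
  where
  cancel : ∀ r q a → (r + q * a) + - q * a ≡ r
  cancel = solve-∀

-- Euclid's algorithm on the first row and column: with a nonzero
-- corner a, shearing replaces the other entries of the first column and
-- row by their remainders mod a; a nonzero remainder is then moved to
-- the corner, strictly decreasing |corner| (bounded by fuel).
reduce-from : ∀ {n} (fuel : ℕ) (M : Mat (suc n) (suc n)) →
              M zero zero ≢ 0ℤ → ℤ.∣ M zero zero ∣ ℕ.< fuel → Reduced M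
reduce-from zero M _ ()
reduce-from {n} (suc fuel) M a≢0 bound = continue (cornerView R)
  where
  a = M zero zero
  instance
    a-nonZero : NonZero a
    a-nonZero = ≢-nonZero a≢0
  R : Mat (suc n) (suc n)
  R = colShear (λ j → - (M zero (suc j) / a)) (rowShear (λ i → - (M (suc i) zero / a)) M)
  M∼R : M ∼ R
  M∼R = ∼-trans (rowShear-∼ _ M) (colShear-∼ _ _)
  R-column : ∀ i → R (suc i) zero ≡ + (M (suc i) zero % a)
  R-column i = x-[x/a]a≡x%a (M (suc i) zero) a
  R-row : ∀ j → R zero (suc j) ≡ + (M zero (suc j) % a)
  R-row j = x-[x/a]a≡x%a (M zero (suc j)) a
  smaller : ∀ {x r} → x ≡ + r → r ℕ.< ℤ.∣ a ∣ → ℤ.∣ x ∣ ℕ.< fuel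
  smaller refl r<a = ℕP.<-≤-trans r<a (ℕP.≤-pred bound)
  continue : CornerView R → Reduced M
  continue (cleared col row) = reduced-∼ M∼R (cleared-reduced R col row)
  continue (in-column i ne)  = reduced-∼ (∼-trans M∼R (swapRows-∼ (suc i) R))
    (reduce-from fuel (swapRows (suc i) R) ne (smaller (R-column i) (n%d<d (M (suc i) zero) a)))
  continue (in-row j ne)     = reduced-∼ (∼-trans M∼R (swapCols-∼ (suc j) R))
    (reduce-from fuel (swapCols (suc j) R) ne (smaller (R-row j) (n%d<d (M zero (suc j)) a)))

reduce : ∀ {n} (M : Mat (suc n) (suc n)) → Reduced M
reduce M with M zero zero ℤ.≟ 0ℤ | cornerView M
... | no a≢0 | _              = reduce-from (suc ℤ.∣ M zero zero ∣) M a≢0 (ℕP.n<1+n _)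
... | yes _  | cleared col row = cleared-reduced M col row
... | yes _  | in-column i ne  = reduced-∼ (swapRows-∼ (suc i) M)
                                   (reduce-from (suc ℤ.∣ M (suc i) zero ∣) _ ne (ℕP.n<1+n _))
... | yes _  | in-row j ne     = reduced-∼ (swapCols-∼ (suc j) M)
                                   (reduce-from (suc ℤ.∣ M zero (suc j) ∣) _ ne (ℕP.n<1+n _))

diagonalize : ∀ {n} (M : Mat n n) → Σ (Fin n → ℤ) λ d → M ∼ diag d
diagonalize {zero}  M = (λ ()) , ∼-ext (λ ())
diagonalize {suc n} M with reduce M
... | a , M′ , M∼blk with diagonalize M′
...   | d′ , M′∼diag = cons a d′ , ∼-trans M∼blk (block-∼ a M′∼diag)

DivisibleBy : ∀ {n} → (Fin n → ℤ) → (Fin n → ℤ) → Set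
DivisibleBy d x = ∀ a → ∃ λ c → x a ≡ c * d a

diag-span⇒divisible : ∀ {n} (d : Fin n → ℤ) {x} → Pres.Span (diag d) x → DivisibleBy d x
diag-span⇒divisible {suc n} d p with BlockSpan.split (d zero) (diag (d ∘ suc)) p
... | head , tail = λ { zero → head ; (suc a) → diag-span⇒divisible (d ∘ suc) tail a }

divisible⇒diag-span : ∀ {n} (d : Fin n → ℤ) {x} → DivisibleBy d x → Pres.Span (diag d) x
divisible⇒diag-span {zero}  d {x} _ = Pres.span-ext (λ ()) Pres.span-zero
divisible⇒diag-span {suc n} d {x} h =
  BlockSpan.combine (d zero) (diag (d ∘ suc)) (proj₁ (h zero)) (proj₂ (h zero))
    (divisible⇒diag-span (d ∘ suc) (h ∘ suc))

VanishesWith : ∀ {n} → (Fin n → ℤ) → (Fin n → ℤ) → Set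
VanishesWith d x = ∀ a → d a ≡ 0ℤ → x a ≡ 0ℤ

-- 1 + pred-exponent d = ∏_a (|d a| if d a ≠ 0, else 1); it kills every
-- torsion element of the diagonal group.  Working with the predecessor
-- keeps positivity visible.
private
  pred-abs-or-1 : ℤ → ℕ
  pred-abs-or-1 (+ zero)   = 0
  pred-abs-or-1 (+ suc k)  = k
  pred-abs-or-1 ℤ.-[1+ k ] = k

  pred-abs-or-1-divisible : ∀ x → x ≢ 0ℤ → ∃ λ s → + suc (pred-abs-or-1 x) ≡ s * x
  pred-abs-or-1-divisible (+ zero)   x≢0 = ⊥-elim (x≢0 refl)
  pred-abs-or-1-divisible (+ suc k)  _   = 1ℤ , sym (ℤP.*-identityˡ _)
  pred-abs-or-1-divisible ℤ.-[1+ k ] _   = - 1ℤ , sym (ℤP.-1*i≡-i ℤ.-[1+ k ])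

pred-exponent : ∀ {n} → (Fin n → ℤ) → ℕ
pred-exponent {zero}  d = 0
pred-exponent {suc n} d = ℕ.pred (suc (pred-abs-or-1 (d zero)) ℕ.* suc (pred-exponent (d ∘ suc)))

exponent-divisible : ∀ {n} (d : Fin n → ℤ) a → d a ≢ 0ℤ → ∃ λ c → + suc (pred-exponent d) ≡ c * d a
exponent-divisible {suc n} d zero d₀≢0 with pred-abs-or-1-divisible (d zero) d₀≢0
... | s , e = s * + rest , (begin
  + (suc (pred-abs-or-1 (d zero)) ℕ.* rest)  ≡⟨ ℤP.pos-* (suc (pred-abs-or-1 (d zero))) rest ⟩
  + suc (pred-abs-or-1 (d zero)) * + rest     ≡⟨ cong (_* + rest) e ⟩
  s * d zero * + rest                   ≡⟨ exchange s (d zero) (+ rest) ⟩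
  s * + rest * d zero                   ∎)
  where
  open ≡-Reasoning
  rest = suc (pred-exponent (d ∘ suc))
  exchange : ∀ s x r → s * x * r ≡ s * r * x
  exchange = solve-∀
exponent-divisible {suc n} d (suc a) dₐ≢0 with exponent-divisible (d ∘ suc) a dₐ≢0
... | c , e = + first * c , (begin
  + (first ℕ.* suc (pred-exponent (d ∘ suc)))  ≡⟨ ℤP.pos-* first _ ⟩
  + first * + suc (pred-exponent (d ∘ suc))    ≡⟨ cong (_*_ (+ first)) e ⟩
  + first * (c * d (suc a))                   ≡⟨ ℤP.*-assoc (+ first) c (d (suc a)) ⟨
  + first * c * d (suc a)                     ∎)
  where
  open ≡-Reasoning
  first = suc (pred-abs-or-1 (d zero))

module DiagonalTorsion {n} (d : Fin n → ℤ) where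
  open Pres (diag d) using (·-pointwise; span-ext)
  open Torsion (Cok (diag d)) using (IsTorsion)
  open Mult (AbelianGroup.monoid (Cok (diag d))) renaming (_×_ to _·_) using ()

  torsion⇒vanishes : ∀ {x} → IsTorsion x → VanishesWith d x
  torsion⇒vanishes {x} (m , p) a dₐ≡0 with diag-span⇒divisible d p a
  ... | c , e with ℤP.i*j≡0⇒i≡0∨j≡0 (+ suc m) {x a} (begin
      + suc m * x a              ≡⟨ ·-pointwise (suc m) x a ⟨
      (suc m · x) a              ≡⟨ ℤP.+-identityʳ _ ⟨
      (suc m · x) a - 0ℤ         ≡⟨ e ⟩
      c * d a                    ≡⟨ cong (c *_) dₐ≡0 ⟩
      c * 0ℤ                     ≡⟨ ℤP.*-zeroʳ c ⟩
      0ℤ                         ∎)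
    where open ≡-Reasoning
  ... | inj₁ ()
  ... | inj₂ xₐ≡0 = xₐ≡0

  -- N x with N = 1 + pred-exponent d is divisible by d wherever d ≠ 0
  vanishes⇒torsion : ∀ {x} → VanishesWith d x → IsTorsion x
  vanishes⇒torsion {x} vanish = pred-exponent d ,
    span-ext (λ g → sym (ℤP.+-identityʳ _)) (divisible⇒diag-span d divisible)
    where
    N = suc (pred-exponent d)
    divisible : DivisibleBy d (N · x)
    divisible a with d a ℤ.≟ 0ℤ
    ... | yes dₐ≡0 = 0ℤ , trans (·-pointwise N x a) (trans (cong (+ N *_) (vanish a dₐ≡0))
                              (trans (ℤP.*-zeroʳ (+ N)) (sym (ℤP.*-zeroˡ (d a)))))
    ... | no dₐ≢0 with exponent-divisible d a dₐ≢0
    ...   | c , e = c * x a , trans (·-pointwise N x a) (trans (cong (_* x a) e) (exchange c (d a) (x a)))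
      where
      exchange : ∀ c y z → c * y * z ≡ c * z * y
      exchange = solve-∀

vectors : ∀ {m} → (Fin m → List ℤ) → List (Fin m → ℤ)
vectors {zero}  cs = (λ ()) ∷ []
vectors {suc m} cs = cartesianProductWith cons (cs zero) (vectors (cs ∘ suc))

vectors-complete : ∀ {m} {cs : Fin m → List ℤ} (P : Fin m → ℤ → Set) →
                   (∀ a → Any (P a) (cs a)) → Any (λ v → ∀ a → P a (v a)) (vectors cs)
vectors-complete {zero}  P found = here (λ ())
vectors-complete {suc m} P found = cartesianProductWith⁺ cons
  (λ p q → λ { zero → p ; (suc a) → q a }) (found zero) (vectors-complete (P ∘ suc) (found ∘ suc))

-- every integer is congruent mod d to an element of residues d
-- (for d = 0 only the value 0 is needed, see diagonal-torsion-finite)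
residues : ℤ → List ℤ
residues d = 0ℤ ∷ map +_ (upTo ℤ.∣ d ∣)

kill : (dₐ x : ℤ) → Dec (dₐ ≡ 0ℤ) → ℤ
kill dₐ x (yes _) = 0ℤ
kill dₐ x (no _)  = x

module _ {n} (d : Fin n → ℤ) where
  open DiagonalTorsion d

  private
    killed : (Fin n → ℤ) → Fin n → ℤ
    killed v a = kill (d a) (v a) (d a ℤ.≟ 0ℤ)

    killed-vanishes : ∀ v → VanishesWith d (killed v)
    killed-vanishes v a dₐ≡0 with d a ℤ.≟ 0ℤ
    ... | yes _    = refl
    ... | no dₐ≢0 = ⊥-elim (dₐ≢0 dₐ≡0)

    residue-found : ∀ a (xₐ : ℤ) → (d a ≡ 0ℤ → xₐ ≡ 0ℤ) → (dec : Dec (d a ≡ 0ℤ)) →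
                    Any (λ z → ∃ λ c → xₐ - kill (d a) z dec ≡ c * d a) (residues (d a))
    residue-found a xₐ vanish (yes dₐ≡0) =
      here (0ℤ , trans (ℤP.+-identityʳ xₐ) (trans (vanish dₐ≡0) (sym (ℤP.*-zeroˡ (d a)))))
    residue-found a xₐ vanish (no dₐ≢0) =
      there (map⁺ (Any.map quotient (∈-upTo⁺ (n%d<d xₐ (d a)))))
      where
      instance
        dₐ-nonZero : NonZero (d a)
        dₐ-nonZero = ≢-nonZero dₐ≢0
      quotient : ∀ {r} → xₐ % d a ≡ r → ∃ λ c → xₐ - + r ≡ c * d a
      quotient refl = xₐ / d a ,
        trans (cong (_-_ xₐ) (sym (x-[x/a]a≡x%a xₐ (d a)))) (cancel xₐ (xₐ / d a) (d a))
        where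
        cancel : ∀ x q d → x - (x + - q * d) ≡ q * d
        cancel = solve-∀

  -- The torsion subgroup of a diagonal presentation is finite: every
  -- torsion element is ≈ a vector with entries in [0, |d a|), zeroed
  -- where d a = 0.
  diagonal-torsion-finite : FiniteGroup (Torsion.torsionSubgroup (Cok (diag d)))
  diagonal-torsion-finite = map representative (vectors (residues ∘ d)) , covered
    where
    representative : (Fin n → ℤ) → Σ (Fin n → ℤ) (Torsion.IsTorsion (Cok (diag d)))
    representative v = killed v , vanishes⇒torsion (killed-vanishes v)
    covered : ∀ t → Any (AbelianGroup._≈_ (Torsion.torsionSubgroup (Cok (diag d))) t)
                        (map representative (vectors (residues ∘ d)))
    covered (x , x-torsion) = map⁺ (Any.map (divisible⇒diag-span d)
      (vectors-complete (λ a z → ∃ λ c → x a - kill (d a) z (d a ℤ.≟ 0ℤ) ≡ c * d a)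
        (λ a → residue-found a (x a) (torsion⇒vanishes {x} x-torsion a) (d a ℤ.≟ 0ℤ))))

torsion-resp : ∀ (G : AbelianGroup 0ℓ 0ℓ) {x y} → AbelianGroup._≈_ G x y →
               Torsion.IsTorsion G y → Torsion.IsTorsion G x
torsion-resp G x≈y (n , p) = n , AbelianGroup.trans G (×-congʳ (suc n) x≈y) p
  where open Mult (AbelianGroup.monoid G) using (×-congʳ)

sum-against-constant : ∀ {k} (y z : Fin k → ℤ) → (∀ j j′ → z j ≡ z j′) →
                       sumℤ y ≡ 0ℤ → sumℤ (λ j → y j * z j) ≡ 0ℤ
sum-against-constant {zero}  y z const Σy≡0 = refl
sum-against-constant {suc k} y z const Σy≡0 = begin
  sumℤ (λ j → y j * z j)       ≡⟨ sum-cong (λ j → cong (y j *_) (const j zero)) ⟩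
  sumℤ (λ j → y j * z zero)    ≡⟨ sum-scalʳ (z zero) y ⟩
  sumℤ y * z zero              ≡⟨ cong (_* z zero) Σy≡0 ⟩
  0ℤ * z zero                  ≡⟨ ℤP.*-zeroˡ (z zero) ⟩
  0ℤ                           ∎
  where open ≡-Reasoning

module SquarePresentation {k} (M : Mat k k) where
  private
    d : Fin k → ℤ
    d = proj₁ (diagonalize M)
    F : Iso (Cok M) (Cok (diag d))
    F = proj₁ (proj₂ (diagonalize M))
    module F = Iso F

  torsion-finite : FiniteGroup (Torsion.torsionSubgroup (Cok M))
  torsion-finite = IsoProperties.finite-from (IsoProperties.onTorsion F) (diagonal-torsion-finite d)

  ConstantKernel : Set
  ConstantKernel = ∀ (z : Fin k → ℤ) → (∀ i → sumℤ (λ j → M i j * z j) ≡ 0ℤ) → ∀ j j′ → z j ≡ z j′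

  module _ (constant-kernel : ConstantKernel) where
    -- Where d a = 0, the a-th diagonal coordinate is a functional on Cok M,
    -- i.e. given by a vector z with M z = 0; z is constant, so the
    -- functional kills every y with Σ y = 0.
    diagonal-coordinate-vanishes : ∀ a → d a ≡ 0ℤ → ∀ y → sumℤ y ≡ 0ℤ → F.to y a ≡ 0ℤ
    diagonal-coordinate-vanishes a dₐ≡0 y Σy≡0 =
      trans (representation coordinate y) (sum-against-constant y z (constant-kernel z Mz≡0) Σy≡0)
      where
      coordinate-cong : ∀ {u v} → AbelianGroup._≈_ (Cok (diag d)) u v → u a ≡ v a
      coordinate-cong {u} {v} p with diag-span⇒divisible d p a
      ... | c , e = ℤP.i-j≡0⇒i≡j (u a) (v a) (trans e (trans (cong (c *_) dₐ≡0) (ℤP.*-zeroʳ c)))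
      coordinate : LinearFunctional (λ x → F.to x a)
      coordinate = record
        { ext = λ {x} {x′} e → coordinate-cong {F.to x} {F.to x′} (F.to-cong (Pres.fromEq M e))
        ; add = λ x x′ → coordinate-cong {F.to (λ g → x g + x′ g)} {λ g → F.to x g + F.to x′ g}
                                          (F.to-homo x x′) }
      z : Fin k → ℤ
      z j = F.to (δ j) a
      Mz≡0 : ∀ i → sumℤ (λ j → M i j * z j) ≡ 0ℤ
      Mz≡0 i = trans (sym (representation coordinate (M i)))
        (trans (coordinate-cong {F.to (M i)} {F.to (λ _ → 0ℤ)} (F.to-cong (Pres.span⇒≈0 M (Pres.span-rel i))))
               (LinearFunctional.zer coordinate))

    sum-zero⇒torsion : ∀ y → sumℤ y ≡ 0ℤ → Torsion.IsTorsion (Cok M) y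
    sum-zero⇒torsion y Σy≡0 =
      torsion-resp (Cok M) {y} {F.from (F.to y)} (AbelianGroup.sym (Cok M) {F.from (F.to y)} {y} (F.from-to y))
        (HomProperties.preserves-torsion (IsoProperties.fromHom F) {F.to y}
          (DiagonalTorsion.vanishes⇒torsion d {F.to y} (λ a dₐ≡0 → diagonal-coordinate-vanishes a dₐ≡0 y Σy≡0)))

  transpose-iso : Iso (Cok M) (Cok (M ᵀ))
  transpose-iso = isoTrans F (isoTrans (ext-iso (diag d) (diag d ᵀ) (λ i j → sym (diag-ᵀ d i j)))
                                       (isoSym (proj₂ (proj₂ (diagonalize M)))))

sum-nonpositive : ∀ {n} (f : Fin n → ℤ) → (∀ w → f w ≤ 0ℤ) → sumℤ f ≤ 0ℤ
sum-nonpositive {zero}  f f≤0 = ℤP.≤-refl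
sum-nonpositive {suc n} f f≤0 = ℤP.+-mono-≤ (f≤0 zero) (sum-nonpositive (f ∘ suc) (f≤0 ∘ suc))

sum-nonpositive-zero : ∀ {n} (f : Fin n → ℤ) → (∀ w → f w ≤ 0ℤ) → sumℤ f ≡ 0ℤ → ∀ w → f w ≡ 0ℤ
sum-nonpositive-zero {suc n} f f≤0 Σf≡0 = λ { zero → head≡0 ; (suc w) → sum-nonpositive-zero (f ∘ suc) (f≤0 ∘ suc) tail≡0 w }
  where
  tail≤0 = sum-nonpositive (f ∘ suc) (f≤0 ∘ suc)
  head≡0 : f zero ≡ 0ℤ
  head≡0 = ℤP.≤-antisym (f≤0 zero)
    (subst (0ℤ ≤_) (sym (ℤ+.inverseˡ-unique (f zero) (sumℤ (f ∘ suc)) Σf≡0)) (ℤP.neg-mono-≤ tail≤0))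
  tail≡0 : sumℤ (f ∘ suc) ≡ 0ℤ
  tail≡0 = trans (sym (ℤP.+-identityˡ _)) (trans (cong (_+ sumℤ (f ∘ suc)) (sym head≡0)) Σf≡0)

argmax : ∀ {n} (z : Fin n → ℤ) → Fin n → ∃ λ m → ∀ j → z j ≤ z m
argmax {suc zero}    z _ = zero , λ { zero → ℤP.≤-refl }
argmax {suc (suc n)} z _ with argmax (z ∘ suc) zero
... | m , z≤zₘ with ℤP.≤-total (z zero) (z (suc m))
...   | inj₁ z₀≤zₘ = suc m , λ { zero → z₀≤zₘ ; (suc j) → z≤zₘ j }
...   | inj₂ zₘ≤z₀ = zero  , λ { zero → ℤP.≤-refl ; (suc j) → ℤP.≤-trans (z≤zₘ j) zₘ≤z₀ }

zeroRowSum-apply : ∀ {k} (off : Fin k → Fin k → ℕ) i (z : Fin k → ℤ) →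
                   sumℤ (λ j → zeroRowSum off i j * z j) ≡ sumℤ (λ j → + off i j * (z j - z i))
zeroRowSum-apply off i z = begin
  sumℤ (λ j → zeroRowSum off i j * z j)             ≡⟨ sum-cong split ⟩
  sumℤ (λ j → o j * z j + diagonal j)               ≡⟨ sum-+ (λ j → o j * z j) diagonal ⟩
  sumℤ (λ j → o j * z j) + sumℤ diagonal            ≡⟨ cong (_+_ (sumℤ (λ j → o j * z j))) (sum-pick i (λ j → - S * z j)) ⟩
  sumℤ (λ j → o j * z j) + - S * z i                ≡⟨ cong (_+_ (sumℤ (λ j → o j * z j))) (sym (ℤP.neg-distribˡ-* S (z i))) ⟩
  sumℤ (λ j → o j * z j) - S * z i                  ≡⟨ cong (_-_ (sumℤ (λ j → o j * z j))) (sym (sum-scalʳ (z i) o)) ⟩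
  sumℤ (λ j → o j * z j) - sumℤ (λ j → o j * z i)   ≡⟨ sum-- (λ j → o j * z j) (λ j → o j * z i) ⟨
  sumℤ (λ j → o j * z j - o j * z i)                ≡⟨ sum-cong factor ⟩
  sumℤ (λ j → + off i j * (z j - z i))              ∎
  where
  open ≡-Reasoning
  o : _ → ℤ
  o j = if ⌊ i ≟ j ⌋ then 0ℤ else + off i j
  S = sumℤ o
  diagonal : _ → ℤ
  diagonal j = if ⌊ i ≟ j ⌋ then - S * z j else 0ℤ
  split : ∀ j → zeroRowSum off i j * z j ≡ o j * z j + diagonal j
  split j with ⌊ i ≟ j ⌋
  ... | true  = sym (ℤP.+-identityˡ _)
  ... | false = sym (ℤP.+-identityʳ _)
  factor : ∀ j → o j * z j - o j * z i ≡ + off i j * (z j - z i)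
  factor j with i ≟ j
  ... | yes refl = sym (trans (cong (+ off i i *_) (ℤP.+-inverseʳ (z i))) (ℤP.*-zeroʳ (+ off i i)))
  ... | no _     = distrib (+ off i j) (z j) (z i)
    where
    distrib : ∀ a x y → a * x - a * y ≡ a * (x - y)
    distrib = solve-∀

module Multigraph {n k} (target source : Fin n → Fin k) where

  edges : Fin k → Fin k → ℕ
  edges i j = count (λ w → ⌊ target w ≟ j ⌋ ∧ ⌊ source w ≟ i ⌋)

  laplacian : Mat k k
  laplacian = zeroRowSum edges

  out-degree in-degree : Fin k → ℤ
  out-degree i = sumℤ (λ w → δ (source w) i)
  in-degree  i = sumℤ (λ w → δ (target w) i)

  edges-as-sum : ∀ i j → + edges i j ≡ sumℤ (λ w → δ (target w) j * δ (source w) i)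
  edges-as-sum i j = trans (count≡sum (λ w → ⌊ target w ≟ j ⌋ ∧ ⌊ source w ≟ i ⌋)) (sum-cong (λ w → indicator-∧ ⌊ target w ≟ j ⌋ ⌊ source w ≟ i ⌋))
    where
    indicator-∧ : ∀ a b → (if a ∧ b then 1ℤ else 0ℤ) ≡ (if a then 1ℤ else 0ℤ) * (if b then 1ℤ else 0ℤ)
    indicator-∧ true  true  = refl
    indicator-∧ true  false = refl
    indicator-∧ false b     = refl

  edges-apply : ∀ i (x : Fin k → ℤ) →
                sumℤ (λ j → + edges i j * x j) ≡ sumℤ (λ w → δ (source w) i * x (target w))
  edges-apply i x = begin
    sumℤ (λ j → + edges i j * x j)
      ≡⟨ sum-cong (λ j → trans (cong (_* x j) (edges-as-sum i j)) (sym (sum-scalʳ (x j) (λ w → δ (target w) j * δ (source w) i)))) ⟩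
    sumℤ (λ j → sumℤ (λ w → δ (target w) j * δ (source w) i * x j))
      ≡⟨ sum-swap (λ j w → δ (target w) j * δ (source w) i * x j) ⟩
    sumℤ (λ w → sumℤ (λ j → δ (target w) j * δ (source w) i * x j))
      ≡⟨ sum-cong (λ w → trans (sum-cong (λ j → reorder (δ (target w) j) (δ (source w) i) (x j)))
                               (sum-scalˡ (δ (source w) i) (λ j → δ (target w) j * x j))) ⟩
    sumℤ (λ w → δ (source w) i * sumℤ (λ j → δ (target w) j * x j))
      ≡⟨ sum-cong (λ w → cong (δ (source w) i *_) (sum-δ-*ˡ (target w) x)) ⟩
    sumℤ (λ w → δ (source w) i * x (target w))
      ∎
    where
    open ≡-Reasoning
    reorder : ∀ a b c → a * b * c ≡ b * (a * c)
    reorder = solve-∀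

  laplacian-apply : ∀ i (z : Fin k → ℤ) →
                    sumℤ (λ j → laplacian i j * z j) ≡ sumℤ (λ w → δ (source w) i * (z (target w) - z i))
  laplacian-apply i z = trans (zeroRowSum-apply edges i z) (edges-apply i (λ j → z j - z i))

  laplacian-diagonal : ∀ i → laplacian i i ≡ + edges i i - out-degree i
  laplacian-diagonal i rewrite ≟-refl i = begin
    - sumℤ (λ j → if ⌊ i ≟ j ⌋ then 0ℤ else + edges i j)   ≡⟨ cong -_ (sum-omit i (λ j → + edges i j)) ⟩
    - (sumℤ (λ j → + edges i j) - + edges i i)             ≡⟨ cong (λ t → - (t - + edges i i)) out-edges ⟩
    - (out-degree i - + edges i i)                          ≡⟨ flip-difference (out-degree i) (+ edges i i) ⟩
    + edges i i - out-degree i                              ∎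
    where
    open ≡-Reasoning
    out-edges : sumℤ (λ j → + edges i j) ≡ out-degree i
    out-edges = trans (sum-cong (λ j → sym (ℤP.*-identityʳ (+ edges i j))))
                      (trans (edges-apply i (λ _ → 1ℤ)) (sum-cong (λ w → ℤP.*-identityʳ (δ (source w) i))))
    flip-difference : ∀ a b → - (a - b) ≡ b - a
    flip-difference = solve-∀

  maximum-propagates : ∀ (z : Fin k → ℤ) i → (∀ j → z j ≤ z i) →
                       sumℤ (λ j → laplacian i j * z j) ≡ 0ℤ →
                       ∀ w → source w ≡ i → z (target w) ≡ z i
  maximum-propagates z i z≤zᵢ Lzᵢ≡0 w refl =
    ℤP.i-j≡0⇒i≡j (z (target w)) (z i)
      (trans (sym (ℤP.*-identityˡ _)) (trans (cong (_* (z (target w) - z i)) (sym (δ-diag i)))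
        (sum-nonpositive-zero term term≤0 (trans (sym (laplacian-apply i z)) Lzᵢ≡0) w)))
    where
    term : Fin n → ℤ
    term w′ = δ (source w′) i * (z (target w′) - z i)
    term≤0 : ∀ w′ → term w′ ≤ 0ℤ
    term≤0 w′ with ⌊ source w′ ≟ i ⌋
    ... | true  = subst (_≤ 0ℤ) (sym (ℤP.*-identityˡ _)) (ℤP.i≤j⇒i-j≤0 (z≤zᵢ (target w′)))
    ... | false = ℤP.≤-refl

laplacian-reverse : ∀ {n k} (target source : Fin n → Fin k) →
                    (∀ i → Multigraph.out-degree target source i ≡ Multigraph.in-degree target source i) →
                    ∀ i j → Multigraph.laplacian source target i j ≡ Multigraph.laplacian target source j i
laplacian-reverse target source balanced i j = by-cases (i ≟ j)
  where
  module G = Multigraph target source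
  module G′ = Multigraph source target
  reversed-edges : ∀ i j → + G′.edges i j ≡ + G.edges j i
  reversed-edges i j = trans (G′.edges-as-sum i j)
    (trans (sum-cong (λ w → ℤP.*-comm (δ (source w) j) (δ (target w) i))) (sym (G.edges-as-sum j i)))
  by-cases : Dec (i ≡ j) → G′.laplacian i j ≡ G.laplacian j i
  by-cases (yes refl) = begin
    G′.laplacian i i                      ≡⟨ G′.laplacian-diagonal i ⟩
    + G′.edges i i - G.in-degree i        ≡⟨ cong₂ _-_ (reversed-edges i i) (sym (balanced i)) ⟩
    + G.edges i i - G.out-degree i        ≡⟨ G.laplacian-diagonal i ⟨
    G.laplacian i i                       ∎
    where open ≡-Reasoning
  by-cases (no i≢j) rewrite ≟-≢ i≢j | ≟-≢ (λ j≡i → i≢j (sym j≡i)) = reversed-edges i j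

module Triangulation (Δ : ColouredTriangulation) where
  open ColouredTriangulation Δ public
  open Groups Δ public

  β : Fin nW → Fin nB
  β = Inverse.to eCS

  black-sum : (e e′ : Fin nW ↔ Fin nB) (f : Fin nB → ℤ) →
              sumℤ (λ w → f (Inverse.to e w)) ≡ sumℤ (λ w → f (Inverse.to e′ w))
  black-sum e e′ f = trans (sum-reindex e f) (sym (sum-reindex e′ f))

  -- T is the Laplacian of the multigraph on R with one edge per CS-edge,
  -- from the R-vertex of its black triangle to that of its white one;
  -- T′ is the Laplacian of the reversed multigraph.
  module Γ = Multigraph wR (bR ∘ β)

  -- every R-vertex has as many black as white triangles around it
  Γ-balanced : ∀ i → Γ.out-degree i ≡ Γ.in-degree i
  Γ-balanced i = trans (black-sum eCS eRC (λ b → δ (bR b) i))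
                       (sum-cong (λ w → cong (λ r → δ r i) (proj₁ (gRC w))))

  T′≡Tᵀ : ∀ i j → T′ i j ≡ T j i
  T′≡Tᵀ = laplacian-reverse wR (bR ∘ β) Γ-balanced

  B-W≅B-B : Iso B-W B-B
  B-W≅B-B = isoTrans (SquarePresentation.transpose-iso T) (ext-iso (T ᵀ) T′ (λ i j → sym (T′≡Tᵀ i j)))

  propagate : (P : Fin nW ⊎ Fin nB → Set) →
              (∀ {f g} → Adjacent eRC eRS eCS f g → (P f → P g) × (P g → P f)) →
              ∀ f g → P f → P g
  propagate P step f g = along (connected f g)
    where
    along : ∀ {f g} → EqClosure (Adjacent eRC eRS eCS) f g → P f → P g
    along ε           p = p
    along (fwd a ◅ r) p = along r (proj₁ (step a) p)
    along (bwd a ◅ r) p = along r (proj₂ (step a) p)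

  rotC : Fin nW → Fin nW
  rotC = rot eRC eCS

  β-rotC : ∀ w → β (rotC w) ≡ Inverse.to eRC w
  β-rotC w = Inverse.strictlyInverseˡ eCS (Inverse.to eRC w)

  -- Along RC- and RS-edges the
  -- R-vertex does not change; from white to black across a CS-edge we
  -- walk around the common C-vertex, which reaches the white triangle
  -- across the RC-edge of that black triangle.
  module RClosure (X : Fin k → Set) (across : ∀ w → X (bR (β w)) → X (wR w)) where

    around-C : ∀ m w → X (wR w) → X (wR (iter rotC m w))
    around-C zero    w x = x
    around-C (suc m) w x = across (rotC (iter rotC m w))
      (subst X (sym (trans (cong bR (β-rotC _)) (proj₁ (gRC _)))) (around-C m w x))

    white-to-black : ∀ w → X (wR w) → X (bR (β w))
    white-to-black w x =
      subst X (trans (sym (proj₁ (gRC w′))) (cong bR (Inverse.strictlyInverseˡ eRC (β w))))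
        (subst (X ∘ wR) (proj₂ cycle) (around-C (proj₁ cycle) w x))
      where
      -- the white triangle across the RC-edge of β w shares its C-vertex with w
      w′ = Inverse.from eRC (β w)
      same-C : wC w ≡ wC w′
      same-C = trans (sym (proj₁ (gCS w)))
        (trans (cong bC (sym (Inverse.strictlyInverseˡ eRC (β w)))) (proj₂ (gRC w′)))
      cycle = cycC w w′ same-C

    face-property : Fin nW ⊎ Fin nB → Set
    face-property (inj₁ w) = X (wR w)
    face-property (inj₂ b) = X (bR b)

    step : ∀ {f g} → Adjacent eRC eRS eCS f g → (face-property f → face-property g) × (face-property g → face-property f)
    step (adj₁ w) = subst X (sym (proj₁ (gRC w))) , subst X (proj₁ (gRC w))
    step (adj₂ w) = subst X (sym (proj₁ (gRS w))) , subst X (proj₁ (gRS w))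
    step (adj₃ w) = white-to-black w , across w

    everywhere : ∀ r₀ → X r₀ → ∀ r → X r
    everywhere r₀ x r with linkR r₀ | linkR r
    ... | w₀ , refl | w , refl = propagate face-property step (inj₁ w₀) (inj₁ w) x

  -- Maximum principle: T z = 0 only for constant z.  The maximum of z
  -- propagates along CS-edges from black to white R-vertices
  -- (Γ.maximum-propagates), hence to all of R.
  T-constant-kernel : SquarePresentation.ConstantKernel T
  T-constant-kernel z Tz≡0 j j′ with argmax z j
  ... | m , z≤zₘ = trans (maximal j) (sym (maximal j′))
    where
    maximal : ∀ r → z r ≡ z m
    maximal = RClosure.everywhere (λ i → z i ≡ z m) across m refl
      where
      across : ∀ w → z (bR (β w)) ≡ z m → z (wR w) ≡ z m
      across w zᵢ≡zₘ = trans (Γ.maximum-propagates z (bR (β w))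
        (λ j → subst (z j ≤_) (sym zᵢ≡zₘ) (z≤zₘ j)) (Tz≡0 (bR (β w))) w refl) zᵢ≡zₘ

subgroup : (G : AbelianGroup 0ℓ 0ℓ) (P : AbelianGroup.Carrier G → Set) →
           P (AbelianGroup.ε G) →
           (∀ {x y} → P x → P y → P (AbelianGroup._∙_ G x y)) →
           (∀ {x} → P x → P (AbelianGroup._⁻¹ G x)) → AbelianGroup 0ℓ 0ℓ
subgroup G P P-ε P-∙ P-⁻¹ = record
  { Carrier = Σ G.Carrier P
  ; _≈_ = λ a b → proj₁ a G.≈ proj₁ b
  ; _∙_ = λ a b → proj₁ a G.∙ proj₁ b , P-∙ (proj₂ a) (proj₂ b)
  ; ε = G.ε , P-ε
  ; _⁻¹ = λ a → proj₁ a G.⁻¹ , P-⁻¹ (proj₂ a)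
  ; isAbelianGroup = record
    { isGroup = record
      { isMonoid = record
        { isSemigroup = record
          { isMagma = record
            { isEquivalence = record { refl = G.refl ; sym = G.sym ; trans = G.trans }
            ; ∙-cong = G.∙-cong }
          ; assoc = λ a b c → G.assoc (proj₁ a) (proj₁ b) (proj₁ c) }
        ; identity = (λ a → G.identityˡ (proj₁ a)) , (λ a → G.identityʳ (proj₁ a)) }
      ; inverse = (λ a → G.inverseˡ (proj₁ a)) , (λ a → G.inverseʳ (proj₁ a))
      ; ⁻¹-cong = G.⁻¹-cong }
    ; comm = λ a b → G.comm (proj₁ a) (proj₁ b) }
  }
  where module G = AbelianGroup G

-- Let φ₁, φ₂ be functionals on ℤ^Gen killing the
-- relators, and e₁, e₂ vectors dual to them.  Then the presented group
-- is ℤ ⊕ ℤ ⊕ K, where K is the common kernel of φ₁ and φ₂; the third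
-- component of a is its projection a − φ₁(a) e₁ − φ₂(a) e₂.
module Splitting {Gen Rel : Set} (rel : Rel → Gen → ℤ)
  {φ₁ φ₂ : (Gen → ℤ) → ℤ} (lin₁ : LinearFunctional φ₁) (lin₂ : LinearFunctional φ₂)
  (kills₁ : ∀ i → φ₁ (rel i) ≡ 0ℤ) (kills₂ : ∀ i → φ₂ (rel i) ≡ 0ℤ)
  (e₁ e₂ : Gen → ℤ) (φ₁e₁ : φ₁ e₁ ≡ 1ℤ) (φ₁e₂ : φ₁ e₂ ≡ 0ℤ) (φ₂e₁ : φ₂ e₁ ≡ 0ℤ) (φ₂e₂ : φ₂ e₂ ≡ 1ℤ)
  where
  open Pres rel
  private
    module L₁ = LinearFunctional lin₁
    module L₂ = LinearFunctional lin₂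

  InKernel : (Gen → ℤ) → Set
  InKernel a = φ₁ a ≡ 0ℤ × φ₂ a ≡ 0ℤ

  Kernel : AbelianGroup 0ℓ 0ℓ
  Kernel = subgroup group InKernel (L₁.zer , L₂.zer)
    (λ {a} {b} (p₁ , p₂) (q₁ , q₂) → trans (L₁.add a b) (cong₂ _+_ p₁ q₁) , trans (L₂.add a b) (cong₂ _+_ p₂ q₂))
    (λ {a} (p₁ , p₂) → trans (L₁.neg a) (cong -_ p₁) , trans (L₂.neg a) (cong -_ p₂))

  combine : ℤ → ℤ → (Gen → ℤ) → Gen → ℤ
  combine p q m g = p * e₁ g + q * e₂ g + m g

  functional-combine : ∀ {φ} → LinearFunctional φ → ∀ p q m →
                       φ (combine p q m) ≡ p * φ e₁ + q * φ e₂ + φ m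
  functional-combine {φ} lin p q m = begin
    φ (combine p q m)                                        ≡⟨ add (λ g → p * e₁ g + q * e₂ g) m ⟩
    φ (λ g → p * e₁ g + q * e₂ g) + φ m                      ≡⟨ cong (_+ φ m) (add (λ g → p * e₁ g) (λ g → q * e₂ g)) ⟩
    φ (λ g → p * e₁ g) + φ (λ g → q * e₂ g) + φ m            ≡⟨ cong₂ (λ x y → x + y + φ m) (scal p e₁) (scal q e₂) ⟩
    p * φ e₁ + q * φ e₂ + φ m                                ∎
    where
    open ≡-Reasoning
    open LinearFunctional lin

  φ₁-combine : ∀ p q m → InKernel m → φ₁ (combine p q m) ≡ p
  φ₁-combine p q m (m₁ , _) = trans (functional-combine lin₁ p q m)
    (trans (cong₂ (λ x y → p * x + q * y + φ₁ m) φ₁e₁ φ₁e₂) (trans (cong (_+_ (p * 1ℤ + q * 0ℤ)) m₁) (simplify p q)))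
    where
    simplify : ∀ p q → p * 1ℤ + q * 0ℤ + 0ℤ ≡ p
    simplify = solve-∀

  φ₂-combine : ∀ p q m → InKernel m → φ₂ (combine p q m) ≡ q
  φ₂-combine p q m (_ , m₂) = trans (functional-combine lin₂ p q m)
    (trans (cong₂ (λ x y → p * x + q * y + φ₂ m) φ₂e₁ φ₂e₂) (trans (cong (_+_ (p * 0ℤ + q * 1ℤ)) m₂) (simplify p q)))
    where
    simplify : ∀ p q → p * 0ℤ + q * 1ℤ + 0ℤ ≡ q
    simplify = solve-∀

  project : (Gen → ℤ) → Gen → ℤ
  project a g = a g - (φ₁ a * e₁ g + φ₂ a * e₂ g)

  project-linear : Linear project
  project-linear g = record
    { ext = λ {a} {a′} e → trans (cong₂ (λ x y → x - (y * e₁ g + φ₂ a * e₂ g)) (e g) (L₁.ext e))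
                                 (cong (λ y → a′ g - (φ₁ a′ * e₁ g + y * e₂ g)) (L₂.ext e))
    ; add = λ a b → trans (cong₂ (λ x y → (a g + b g) - (x * e₁ g + y * e₂ g)) (L₁.add a b) (L₂.add a b))
                          (regroup (a g) (b g) (φ₁ a) (φ₁ b) (φ₂ a) (φ₂ b) (e₁ g) (e₂ g)) }
    where
    regroup : ∀ a b p p′ q q′ u v → (a + b) - ((p + p′) * u + (q + q′) * v) ≡ (a - (p * u + q * v)) + (b - (p′ * u + q′ * v))
    regroup = solve-∀

  project-combine : ∀ a g → combine (φ₁ a) (φ₂ a) (project a) g ≡ a g
  project-combine a g = cancel (φ₁ a * e₁ g) (φ₂ a * e₂ g) (a g)
    where
    cancel : ∀ x y a → x + y + (a - (x + y)) ≡ a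
    cancel = solve-∀

  functional-project : ∀ {φ} → LinearFunctional φ → ∀ a →
                       φ (project a) ≡ φ a - (φ₁ a * φ e₁ + φ₂ a * φ e₂)
  functional-project {φ} lin a = begin
    φ (project a)                                    ≡⟨ add-sub (φ (project a)) A ⟩
    (φ₁ a * φ e₁ + φ₂ a * φ e₂ + φ (project a)) - A   ≡⟨ cong (_- A) (functional-combine lin (φ₁ a) (φ₂ a) (project a)) ⟨
    φ (combine (φ₁ a) (φ₂ a) (project a)) - A         ≡⟨ cong (_- A) (LinearFunctional.ext lin (project-combine a)) ⟩
    φ a - A                                          ∎
    where
    open ≡-Reasoning
    A = φ₁ a * φ e₁ + φ₂ a * φ e₂
    add-sub : ∀ y A → y ≡ (A + y) - A
    add-sub = solve-∀

  project-in-kernel : ∀ a → InKernel (project a)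
  project-in-kernel a =
    trans (functional-project lin₁ a) (trans (cong₂ (λ u v → φ₁ a - (φ₁ a * u + φ₂ a * v)) φ₁e₁ φ₁e₂) (vanish₁ (φ₁ a) (φ₂ a))) ,
    trans (functional-project lin₂ a) (trans (cong₂ (λ u v → φ₂ a - (φ₁ a * u + φ₂ a * v)) φ₂e₁ φ₂e₂) (vanish₂ (φ₁ a) (φ₂ a)))
    where
    vanish₁ : ∀ x y → x - (x * 1ℤ + y * 0ℤ) ≡ 0ℤ
    vanish₁ = solve-∀
    vanish₂ : ∀ x y → y - (x * 0ℤ + y * 1ℤ) ≡ 0ℤ
    vanish₂ = solve-∀

  project-kernel : ∀ a → InKernel a → ∀ g → project a g ≡ a g
  project-kernel a (a₁ , a₂) g = trans (cong₂ (λ x y → a g - (x * e₁ g + y * e₂ g)) a₁ a₂) (vanish (a g) (e₁ g) (e₂ g))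
    where
    vanish : ∀ a u v → a - (0ℤ * u + 0ℤ * v) ≡ a
    vanish = solve-∀

  split-iso : Iso group (ℤ²⊕ Kernel)
  split-iso = record
    { to = λ a → φ₁ a , φ₂ a , project a , project-in-kernel a
    ; from = λ { (p , q , m , _) → combine p q m }
    ; to-cong = λ {a} {a′} a≈a′ → functional-cong lin₁ kills₁ a≈a′ , functional-cong lin₂ kills₂ a≈a′ ,
        span-ext (projection-difference a a′ (functional-cong lin₁ kills₁ a≈a′) (functional-cong lin₂ kills₂ a≈a′)) a≈a′
    ; from-cong = λ { {p , q , m , _} {.p , .q , m′ , _} (refl , refl , m≈m′) →
        span-ext (λ g → common (p * e₁ g + q * e₂ g) (m g) (m′ g)) m≈m′ }
    ; to-homo = λ a b → L₁.add a b , L₂.add a b , fromEq (λ g → LinearFunctional.add (project-linear g) a b)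
    ; to-from = λ { (p , q , m , m∈K) → φ₁-combine p q m m∈K , φ₂-combine p q m m∈K ,
        fromEq (λ g → trans (cong₂ (λ x y → combine p q m g - (x * e₁ g + y * e₂ g)) (φ₁-combine p q m m∈K) (φ₂-combine p q m m∈K))
                            (cancel (p * e₁ g + q * e₂ g) (m g))) }
    ; from-to = λ a → fromEq (project-combine a) }
    where
    projection-difference : ∀ a a′ → φ₁ a ≡ φ₁ a′ → φ₂ a ≡ φ₂ a′ → ∀ g → a g - a′ g ≡ project a g - project a′ g
    projection-difference a a′ same₁ same₂ g =
      trans (shift (a g) (a′ g) (φ₁ a * e₁ g + φ₂ a * e₂ g))
            (cong₂ (λ x y → project a g - (a′ g - (x * e₁ g + y * e₂ g))) same₁ same₂)
      where
      shift : ∀ x x′ E → x - x′ ≡ (x - E) - (x′ - E)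
      shift = solve-∀
    common : ∀ E x x′ → x - x′ ≡ (E + x) - (E + x′)
    common = solve-∀
    cancel : ∀ E x → E + x - E ≡ x
    cancel = solve-∀

module WhiteGroups (Δ : ColouredTriangulation) where
  open Triangulation Δ

  relW : Fin nW → Vtx → ℤ
  relW w = triRel (wR w) (wC w) (wS w)

  module AW = Pres relW
  module A-W = AbelianGroup A-W

  eR : Fin k → Vtx → ℤ
  eR r (inj₁ r′) = δ r r′
  eR r (inj₂ _)  = 0ℤ

  eC : Fin nC → Vtx → ℤ
  eC c (inj₁ _)         = 0ℤ
  eC c (inj₂ (inj₁ c′)) = δ c c′
  eC c (inj₂ (inj₂ _))  = 0ℤ

  eS : Fin nS → Vtx → ℤ
  eS s (inj₁ _)         = 0ℤ
  eS s (inj₂ (inj₁ _))  = 0ℤ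
  eS s (inj₂ (inj₂ s′)) = δ s s′

  relW-vertices : ∀ w v → relW w v ≡ eR (wR w) v + eC (wC w) v + eS (wS w) v
  relW-vertices w (inj₁ r)        = sym (trans (ℤP.+-identityʳ _) (ℤP.+-identityʳ _))
  relW-vertices w (inj₂ (inj₁ c)) = sym (trans (ℤP.+-identityʳ _) (ℤP.+-identityˡ _))
  relW-vertices w (inj₂ (inj₂ s)) = sym (ℤP.+-identityˡ _)

  private
    sum-*0 : ∀ {n} (f : Fin n → ℤ) → sumℤ (λ i → f i * 0ℤ) ≡ 0ℤ
    sum-*0 f = sum-zero (λ i → ℤP.*-zeroʳ (f i))

  vertex-expansion : ∀ (a : Vtx → ℤ) v →
    a v ≡ sumℤ (λ r → a (inj₁ r) * eR r v) + sumℤ (λ c → a (inj₂ (inj₁ c)) * eC c v)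
                                           + sumℤ (λ s → a (inj₂ (inj₂ s)) * eS s v)
  vertex-expansion a (inj₁ r) = sym (trans (cong₂ (λ x y → sumℤ (λ r′ → a (inj₁ r′) * δ r′ r) + x + y)
    (sum-*0 (a ∘ inj₂ ∘ inj₁)) (sum-*0 (a ∘ inj₂ ∘ inj₂)))
    (trans (ℤP.+-identityʳ _) (trans (ℤP.+-identityʳ _) (sum-δ-*ʳ r (a ∘ inj₁)))))
  vertex-expansion a (inj₂ (inj₁ c)) = sym (trans (cong₂ (λ x y → x + sumℤ (λ c′ → a (inj₂ (inj₁ c′)) * δ c′ c) + y)
    (sum-*0 (a ∘ inj₁)) (sum-*0 (a ∘ inj₂ ∘ inj₂)))
    (trans (ℤP.+-identityʳ _) (trans (ℤP.+-identityˡ _) (sum-δ-*ʳ c (a ∘ inj₂ ∘ inj₁)))))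
  vertex-expansion a (inj₂ (inj₂ s)) = sym (trans (cong₂ (λ x y → x + y + sumℤ (λ s′ → a (inj₂ (inj₂ s′)) * δ s′ s))
    (sum-*0 (a ∘ inj₁)) (sum-*0 (a ∘ inj₂ ∘ inj₁)))
    (trans (ℤP.+-identityˡ _) (sum-δ-*ʳ s (a ∘ inj₂ ∘ inj₂))))

  ι : (Fin k → ℤ) → Vtx → ℤ
  ι y (inj₁ r) = y r
  ι y (inj₂ _) = 0ℤ

  ι-linear : Linear ι
  ι-linear (inj₁ r) = record { ext = λ e → e r ; add = λ _ _ → refl }
  ι-linear (inj₂ _) = record { ext = λ _ → refl ; add = λ _ _ → refl }

  signed-sum : ∀ i (X : Fin nW → ℤ) →
    sumℤ (λ w → (δ (bR (β w)) i - δ (wR w) i) * X w)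
      ≡ sumℤ (λ w → δ (bR (β w)) i * X w) - sumℤ (λ w → δ (wR w) i * X w)
  signed-sum i X = trans (sum-cong (λ w → distrib (δ (bR (β w)) i) (δ (wR w) i) (X w)))
                         (sum-- (λ w → δ (bR (β w)) i * X w) (λ w → δ (wR w) i * X w))
    where
    distrib : ∀ a b x → (a - b) * x ≡ a * x - b * x
    distrib = solve-∀

  -- The C- and S-parts of the relators around the black and the white
  -- R-vertex i agree, since a CS-edge and the RC- (RS-) edge of a black
  -- triangle share their C- (S-) vertex.
  C-parts-agree : ∀ i c → sumℤ (λ w → δ (bR (β w)) i * δ (wC w) c) ≡ sumℤ (λ w → δ (wR w) i * δ (wC w) c)
  C-parts-agree i c =
    trans (sum-cong (λ w → cong (λ t → δ (bR (β w)) i * δ t c) (sym (proj₁ (gCS w)))))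
      (trans (black-sum eCS eRC (λ b → δ (bR b) i * δ (bC b) c))
        (sum-cong (λ w → cong₂ (λ x y → δ x i * δ y c) (proj₁ (gRC w)) (proj₂ (gRC w)))))

  S-parts-agree : ∀ i s → sumℤ (λ w → δ (bR (β w)) i * δ (wS w) s) ≡ sumℤ (λ w → δ (wR w) i * δ (wS w) s)
  S-parts-agree i s =
    trans (sum-cong (λ w → cong (λ t → δ (bR (β w)) i * δ t s) (sym (proj₂ (gCS w)))))
      (trans (black-sum eCS eRS (λ b → δ (bR b) i * δ (bS b) s))
        (sum-cong (λ w → cong₂ (λ x y → δ x i * δ y s) (proj₁ (gRS w)) (proj₂ (gRS w)))))

  -- The R-parts differ by the i-th row of T (by Γ.laplacian-apply and
  -- the balance of Γ).
  R-parts-differ : ∀ i r → sumℤ (λ w → δ (bR (β w)) i * δ (wR w) r) - sumℤ (λ w → δ (wR w) i * δ (wR w) r) ≡ T i r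
  R-parts-differ i r = begin
    sumℤ (λ w → δ (bR (β w)) i * δ (wR w) r) - sumℤ (λ w → δ (wR w) i * δ (wR w) r)
      ≡⟨ cong (_-_ (sumℤ (λ w → δ (bR (β w)) i * δ (wR w) r))) white-part ⟩
    sumℤ (λ w → δ (bR (β w)) i * δ (wR w) r) - sumℤ (λ w → δ (bR (β w)) i * δ i r)
      ≡⟨ sum-- (λ w → δ (bR (β w)) i * δ (wR w) r) (λ w → δ (bR (β w)) i * δ i r) ⟨
    sumℤ (λ w → δ (bR (β w)) i * δ (wR w) r - δ (bR (β w)) i * δ i r)
      ≡⟨ sum-cong (λ w → factor (δ (bR (β w)) i) (δ (wR w) r) (δ i r)) ⟩
    sumℤ (λ w → δ (bR (β w)) i * (δ (wR w) r - δ i r))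
      ≡⟨ Γ.laplacian-apply i (λ j → δ j r) ⟨
    sumℤ (λ j → T i j * δ j r)
      ≡⟨ sum-δ-*ʳ r (T i) ⟩
    T i r ∎
    where
    open ≡-Reasoning
    factor : ∀ a x y → a * x - a * y ≡ a * (x - y)
    factor = solve-∀
    δ-squared : ∀ (a : Fin k) → δ a i * δ a r ≡ δ a i * δ i r
    δ-squared a with a ≟ i
    ... | yes refl = refl
    ... | no _     = refl
    white-part : sumℤ (λ w → δ (wR w) i * δ (wR w) r) ≡ sumℤ (λ w → δ (bR (β w)) i * δ i r)
    white-part = trans (sum-cong (λ w → δ-squared (wR w)))
      (trans (sum-scalʳ (δ i r) (λ w → δ (wR w) i))
        (trans (cong (_* δ i r) (sym (Γ-balanced i))) (sym (sum-scalʳ (δ i r) (λ w → δ (bR (β w)) i)))))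

  -- ι (row i of T) = Σ_w (δ(bR (β w)) i − δ(wR w) i) · (white relator of w)
  ι-relator : ∀ i → AW.Span (ι (T i))
  ι-relator i = AW.span-ext coordinates (AW.span-combination (λ w → δ (bR (β w)) i - δ (wR w) i) relW AW.span-rel)
    where
    coordinates : ∀ v → sumℤ (λ w → (δ (bR (β w)) i - δ (wR w) i) * relW w v) ≡ ι (T i) v
    coordinates (inj₁ r)        = trans (signed-sum i (λ w → δ (wR w) r)) (R-parts-differ i r)
    coordinates (inj₂ (inj₁ c)) = trans (signed-sum i (λ w → δ (wC w) c))
      (trans (cong (_- sumℤ (λ w → δ (wR w) i * δ (wC w) c)) (C-parts-agree i c)) (ℤP.+-inverseʳ (sumℤ (λ w → δ (wR w) i * δ (wC w) c))))
    coordinates (inj₂ (inj₂ s)) = trans (signed-sum i (λ w → δ (wS w) s))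
      (trans (cong (_- sumℤ (λ w → δ (wR w) i * δ (wS w) s)) (S-parts-agree i s)) (ℤP.+-inverseʳ (sumℤ (λ w → δ (wR w) i * δ (wS w) s))))

  ι-hom : Hom B-W A-W
  ι-hom = linear-hom ι-linear ι-relator

  -- In B-W the torsion elements are exactly the vectors with coordinate
  -- sum 0: the sum is well defined since the rows of T sum to 0, and
  -- conversely by the maximum principle for T.
  T-row-sum : ∀ i → sumℤ (T i) ≡ 0ℤ
  T-row-sum i = trans (sum-cong (λ j → sym (ℤP.*-identityʳ (T i j))))
    (trans (Γ.laplacian-apply i (λ _ → 1ℤ))
           (sum-zero (λ w → trans (cong (δ (bR (β w)) i *_) (ℤP.+-inverseʳ 1ℤ)) (ℤP.*-zeroʳ (δ (bR (β w)) i)))))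

  torsion⇒sum-zero : ∀ {y} → Torsion.IsTorsion B-W y → sumℤ y ≡ 0ℤ
  torsion⇒sum-zero {y} (n , p) with ℤP.i*j≡0⇒i≡0∨j≡0 (+ suc n) {sumℤ y} multiple≡0
    where
    multiple≡0 : + suc n * sumℤ y ≡ 0ℤ
    multiple≡0 = trans (sym (sum-scalˡ (+ suc n) y))
      (trans (sum-cong (λ g → trans (sym (Pres.·-pointwise T (suc n) y g)) (sym (ℤP.+-identityʳ _))))
             (Pres.functional-span T sum-linear T-row-sum p))
  ... | inj₁ ()
  ... | inj₂ Σy≡0 = Σy≡0

  sum-zero⇒torsion : ∀ y → sumℤ y ≡ 0ℤ → Torsion.IsTorsion B-W y
  sum-zero⇒torsion = SquarePresentation.sum-zero⇒torsion T T-constant-kernel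

  Reachable : (Vtx → ℤ) → Set
  Reachable a = ∃ λ y → sumℤ y ≡ 0ℤ × ι y A-W.≈ a

  reachable-resp : ∀ {a b} → a A-W.≈ b → Reachable a → Reachable b
  reachable-resp {a} {b} a≈b (y , Σy≡0 , ιy≈a) = y , Σy≡0 , A-W.trans {ι y} {a} {b} ιy≈a a≈b

  reachable-ext : ∀ {a b} → (∀ v → a v ≡ b v) → Reachable a → Reachable b
  reachable-ext {a} {b} e = reachable-resp {a} {b} (AW.fromEq e)

  reachable-+ : ∀ {a b} → Reachable a → Reachable b → Reachable (λ v → a v + b v)
  reachable-+ {a} {b} (y , Σy≡0 , ιy≈a) (y′ , Σy′≡0 , ιy′≈b) =
    (λ j → y j + y′ j) , trans (sum-+ y y′) (cong₂ _+_ Σy≡0 Σy′≡0) ,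
    A-W.trans {ι (λ j → y j + y′ j)} {λ v → ι y v + ι y′ v} {λ v → a v + b v}
      (Hom.homo ι-hom y y′) (A-W.∙-cong {ι y} {a} {ι y′} {b} ιy≈a ιy′≈b)

  reachable-scal : ∀ c {a} → Reachable a → Reachable (λ v → c * a v)
  reachable-scal c {a} (y , Σy≡0 , ιy≈a) =
    (λ j → c * y j) , trans (sum-scalˡ c y) (trans (cong (c *_) Σy≡0) (ℤP.*-zeroʳ c)) ,
    AW.span-ext coordinates (AW.span-scal c ιy≈a)
    where
    coordinates : ∀ v → c * (ι y v - a v) ≡ ι (λ j → c * y j) v - c * a v
    coordinates (inj₁ r) = distrib c (y r) (a (inj₁ r))
      where distrib : ∀ c x y → c * (x - y) ≡ c * x - c * y
            distrib = solve-∀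
    coordinates (inj₂ u) = distrib c (a (inj₂ u))
      where distrib : ∀ c y → c * (0ℤ - y) ≡ 0ℤ - c * y
            distrib = solve-∀

  reachable-zero : Reachable (λ _ → 0ℤ)
  reachable-zero = (λ _ → 0ℤ) , sum-zero {k} (λ _ → refl) , AW.fromEq {ι (λ _ → 0ℤ)} {λ _ → 0ℤ} (λ { (inj₁ _) → refl ; (inj₂ _) → refl })

  reachable-combination : ∀ {m} (u : Fin m → ℤ) (f : Fin m → Vtx → ℤ) → (∀ i → Reachable (f i)) →
                          Reachable (λ v → sumℤ (λ i → u i * f i v))
  reachable-combination {zero}  u f reach = reachable-zero
  reachable-combination {suc m} u f reach =
    reachable-+ (reachable-scal (u zero) (reach zero)) (reachable-combination (u ∘ suc) (f ∘ suc) (reach ∘ suc))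

  w₀ : Fin nW
  w₀ = fromℕ< nonempty

  r₁ : Fin k
  r₁ = wR w₀

  c₁ : Fin nC
  c₁ = wC w₀

  R-differences : ∀ r → Reachable (λ v → eR r v - eR r₁ v)
  R-differences r = (λ j → δ r j - δ r₁ j) , trans (sum-- (δ r) (δ r₁)) (cong₂ _-_ (sum-δ r) (sum-δ r₁)) ,
                    AW.fromEq {ι (λ j → δ r j - δ r₁ j)} {λ v → eR r v - eR r₁ v} (λ { (inj₁ _) → refl ; (inj₂ _) → refl })

  -- Across the RS-edge of w, the C-vertices of w and of the black
  -- triangle b differ by a reachable element: subtract the relator of w
  -- from that of the white triangle w′ sharing the CS-edge of b.
  C-difference-across-RS : ∀ w → Reachable (λ v → eC (wC w) v - eC (bC (Inverse.to eRS w)) v)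
  C-difference-across-RS w =
    (λ j → δ (wR w′) j - δ (wR w) j) ,
    trans (sum-- (δ (wR w′)) (δ (wR w))) (cong₂ _-_ (sum-δ (wR w′)) (sum-δ (wR w))) ,
    AW.span-ext coordinates (AW.span-sub (AW.span-rel w′) (AW.span-rel w))
    where
    b = Inverse.to eRS w
    w′ = Inverse.from eCS b
    β-w′ : β w′ ≡ b
    β-w′ = Inverse.strictlyInverseˡ eCS b
    same-S : wS w′ ≡ wS w
    same-S = trans (sym (proj₂ (gCS w′))) (trans (cong bS β-w′) (proj₂ (gRS w)))
    C-of-b : bC b ≡ wC w′
    C-of-b = trans (cong bC (sym β-w′)) (proj₁ (gCS w′))
    coordinates : ∀ v → relW w′ v - relW w v ≡ ι (λ j → δ (wR w′) j - δ (wR w) j) v - (eC (wC w) v - eC (bC b) v)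
    coordinates (inj₁ j)        = sym (ℤP.+-identityʳ _)
    coordinates (inj₂ (inj₁ c)) = trans (flip (δ (wC w′) c) (δ (wC w) c))
                                        (cong (λ t → 0ℤ - (δ (wC w) c - δ t c)) (sym C-of-b))
      where flip : ∀ x y → x - y ≡ 0ℤ - (y - x)
            flip = solve-∀
    coordinates (inj₂ (inj₂ s)) = trans (cong (λ t → δ t s - δ (wS w) s) same-S) (ℤP.+-inverseʳ (δ (wS w) s))

  C-differences : ∀ c → Reachable (λ v → eC c v - eC c₁ v)
  C-differences c with linkC c
  ... | w , refl = propagate face-property step (inj₁ w₀) (inj₁ w)
                     (reachable-ext (λ v → sym (ℤP.+-inverseʳ (eC c₁ v))) reachable-zero)
    where
    face-property : Fin nW ⊎ Fin nB → Set
    face-property (inj₁ w) = Reachable (λ v → eC (wC w) v - eC c₁ v)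
    face-property (inj₂ b) = Reachable (λ v → eC (bC b) v - eC c₁ v)
    via : ∀ {c c′} → c ≡ c′ → Reachable (λ v → eC c v - eC c₁ v) → Reachable (λ v → eC c′ v - eC c₁ v)
    via refl r = r
    step : ∀ {f g} → Adjacent eRC eRS eCS f g → (face-property f → face-property g) × (face-property g → face-property f)
    step (adj₁ w) = via (sym (proj₂ (gRC w))) , via (proj₂ (gRC w))
    step (adj₂ w) =
      (λ r → reachable-ext (λ v → subtract (eC (wC w) v) (eC (bC (Inverse.to eRS w)) v) (eC c₁ v))
               (reachable-+ r (reachable-scal (- 1ℤ) (C-difference-across-RS w)))) ,
      (λ r → reachable-ext (λ v → add (eC (wC w) v) (eC (bC (Inverse.to eRS w)) v) (eC c₁ v))
               (reachable-+ r (C-difference-across-RS w)))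
      where
      subtract : ∀ a b c → (a - c) + (- 1ℤ) * (a - b) ≡ b - c
      subtract = solve-∀
      add : ∀ a b c → (b - c) + (a - b) ≡ a - c
      add = solve-∀
    step (adj₃ w) = via (sym (proj₁ (gCS w))) , via (proj₁ (gCS w))

  -- s + c₁ + r₁ is reachable: by the relator of a triangle at s it is
  -- −(c − c₁) − (r − r₁)
  S-sums : ∀ s → Reachable (λ v → eS s v + eC c₁ v + eR r₁ v)
  S-sums s with linkS s
  ... | w , refl = reachable-resp {a} {λ v → eS (wS w) v + eC c₁ v + eR r₁ v}
                     (AW.span-ext coordinates (AW.span-neg (AW.span-rel w)))
                     (reachable-+ (reachable-scal (- 1ℤ) (C-differences (wC w))) (reachable-scal (- 1ℤ) (R-differences (wR w))))
    where
    a : Vtx → ℤ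
    a v = (- 1ℤ) * (eC (wC w) v - eC c₁ v) + (- 1ℤ) * (eR (wR w) v - eR r₁ v)
    coordinates : ∀ v → - relW w v ≡ a v - (eS (wS w) v + eC c₁ v + eR r₁ v)
    coordinates v = trans (cong -_ (relW-vertices w v)) (rearrange (eR (wR w) v) (eC (wC w) v) (eS (wS w) v) (eR r₁ v) (eC c₁ v))
      where
      rearrange : ∀ R C S R₁ C₁ → - (R + C + S) ≡ ((- 1ℤ) * (C - C₁) + (- 1ℤ) * (R - R₁)) - (S + C₁ + R₁)
      rearrange = solve-∀

  ΣR ΣC ΣS : (Vtx → ℤ) → ℤ
  ΣR a = sumℤ (a ∘ inj₁)
  ΣC a = sumℤ (a ∘ inj₂ ∘ inj₁)
  ΣS a = sumℤ (a ∘ inj₂ ∘ inj₂)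

  φ₁ φ₂ : (Vtx → ℤ) → ℤ
  φ₁ a = ΣR a - ΣS a
  φ₂ a = ΣC a - ΣS a

  φ₁-linear : LinearFunctional φ₁
  φ₁-linear = difference (precompose inj₁ sum-linear) (precompose (inj₂ ∘ inj₂) sum-linear)

  φ₂-linear : LinearFunctional φ₂
  φ₂-linear = difference (precompose (inj₂ ∘ inj₁) sum-linear) (precompose (inj₂ ∘ inj₂) sum-linear)

  φ₁-kills : ∀ w → φ₁ (relW w) ≡ 0ℤ
  φ₁-kills w = cong₂ _-_ (sum-δ (wR w)) (sum-δ (wS w))

  φ₂-kills : ∀ w → φ₂ (relW w) ≡ 0ℤ
  φ₂-kills w = cong₂ _-_ (sum-δ (wC w)) (sum-δ (wS w))

  private
    Σ0 : ∀ {n} → sumℤ {n} (λ _ → 0ℤ) ≡ 0ℤ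
    Σ0 {n} = sum-zero {n} (λ _ → refl)

  φ₁-eR : ∀ r → φ₁ (eR r) ≡ 1ℤ
  φ₁-eR r = cong₂ _-_ (sum-δ r) (Σ0 {nS})
  φ₂-eR : ∀ r → φ₂ (eR r) ≡ 0ℤ
  φ₂-eR r = cong₂ _-_ (Σ0 {nC}) (Σ0 {nS})
  φ₁-eC : ∀ c → φ₁ (eC c) ≡ 0ℤ
  φ₁-eC c = cong₂ _-_ (Σ0 {k}) (Σ0 {nS})
  φ₂-eC : ∀ c → φ₂ (eC c) ≡ 1ℤ
  φ₂-eC c = cong₂ _-_ (sum-δ c) (Σ0 {nS})
  φ₁-eS : ∀ s → φ₁ (eS s) ≡ - 1ℤ
  φ₁-eS s = cong₂ _-_ (Σ0 {k}) (sum-δ s)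
  φ₂-eS : ∀ s → φ₂ (eS s) ≡ - 1ℤ
  φ₂-eS s = cong₂ _-_ (Σ0 {nC}) (sum-δ s)

  module Split = Splitting relW φ₁-linear φ₂-linear φ₁-kills φ₂-kills
                   (eR r₁) (eC c₁) (φ₁-eR r₁) (φ₁-eC c₁) (φ₂-eR r₁) (φ₂-eC c₁)
  open Split using (project; Kernel)

  project-unit : ∀ u {p q} → φ₁ u ≡ p → φ₂ u ≡ q → ∀ v → project u v ≡ u v - (p * eR r₁ v + q * eC c₁ v)
  project-unit u φ₁u φ₂u v = cong₂ (λ x y → u v - (x * eR r₁ v + y * eC c₁ v)) φ₁u φ₂u

  -- Every projection is reachable: the projections of the unit vectors
  -- are r − r₁, c − c₁ and s + r₁ + c₁, and projection is linear.
  project-reachable : ∀ a → Reachable (project a)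
  project-reachable a = reachable-ext expand
    (reachable-+ (reachable-+ (combination (a ∘ inj₁) eR R-units) (combination (a ∘ inj₂ ∘ inj₁) eC C-units))
                 (combination (a ∘ inj₂ ∘ inj₂) eS S-units))
    where
    combination : ∀ {m} (u : Fin m → ℤ) (f : Fin m → Vtx → ℤ) → (∀ i → Reachable (project (f i))) →
                  Reachable (project (λ v → sumℤ (λ i → u i * f i v)))
    combination u f reach = reachable-ext (λ v → sym (trans (LinearFunctional.sum (Split.project-linear v) (λ i g → u i * f i g))
                                                           (sum-cong (λ i → LinearFunctional.scal (Split.project-linear v) (u i) (f i)))))
                                          (reachable-combination u (project ∘ f) reach)
    R-units : ∀ r → Reachable (project (eR r))
    R-units r = reachable-ext (λ v → sym (trans (project-unit (eR r) (φ₁-eR r) (φ₂-eR r) v) (simplify (eR r v) (eR r₁ v) (eC c₁ v))))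
                              (R-differences r)
      where simplify : ∀ x r c → x - (1ℤ * r + 0ℤ * c) ≡ x - r
            simplify = solve-∀
    C-units : ∀ c → Reachable (project (eC c))
    C-units c = reachable-ext (λ v → sym (trans (project-unit (eC c) (φ₁-eC c) (φ₂-eC c) v) (simplify (eC c v) (eR r₁ v) (eC c₁ v))))
                              (C-differences c)
      where simplify : ∀ x r c → x - (0ℤ * r + 1ℤ * c) ≡ x - c
            simplify = solve-∀
    S-units : ∀ s → Reachable (project (eS s))
    S-units s = reachable-ext (λ v → sym (trans (project-unit (eS s) (φ₁-eS s) (φ₂-eS s) v) (simplify (eS s v) (eR r₁ v) (eC c₁ v))))
                              (S-sums s)
      where simplify : ∀ x r c → x - ((- 1ℤ) * r + (- 1ℤ) * c) ≡ x + c + r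
            simplify = solve-∀
    R-part C-part S-part : Vtx → ℤ
    R-part v = sumℤ (λ r → a (inj₁ r) * eR r v)
    C-part v = sumℤ (λ c → a (inj₂ (inj₁ c)) * eC c v)
    S-part v = sumℤ (λ s → a (inj₂ (inj₂ s)) * eS s v)
    expand : ∀ v → project R-part v + project C-part v + project S-part v ≡ project a v
    expand v = sym (trans (ext (vertex-expansion a))
                     (trans (add (λ v′ → R-part v′ + C-part v′) S-part) (cong (_+ project S-part v) (add R-part C-part))))
      where open LinearFunctional (Split.project-linear v)

  -- ι maps torsion elements into the kernel of φ₁ and φ₂ ...
  ι-torsion-in-kernel : ∀ {y} → Torsion.IsTorsion B-W y → Split.InKernel (ι y)
  ι-torsion-in-kernel {y} t = trans (cong₂ _-_ (torsion⇒sum-zero t) (Σ0 {nS})) refl ,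
                              trans (cong₂ _-_ (Σ0 {nC}) (Σ0 {nS})) refl

  C-W→Kernel : Hom C-W Kernel
  C-W→Kernel = record
    { fun      = λ t → ι (proj₁ t) , ι-torsion-in-kernel (proj₂ t)
    ; fun-cong = Hom.fun-cong ι-hom
    ; homo     = λ s t → Hom.homo ι-hom (proj₁ s) (proj₁ t) }

  -- ... and onto it: an element a of the kernel equals its projection,
  -- which is ι y for some y with coordinate sum 0, i.e. y torsion.
  Kernel-quotient : IsQuotientOf C-W Kernel
  Kernel-quotient = surjection⇒quotient C-W→Kernel preimage
    where
    preimage : ∀ k → ∃ λ t → AbelianGroup._≈_ Kernel (Hom.fun C-W→Kernel t) k
    preimage (a , a∈K) = (y , sum-zero⇒torsion y Σy≡0) ,
                         A-W.trans {ι y} {project a} {a} ιy≈πa (AW.fromEq {project a} {a} (Split.project-kernel a a∈K))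
      where
      y = proj₁ (project-reachable a)
      Σy≡0 = proj₁ (proj₂ (project-reachable a))
      ιy≈πa = proj₂ (proj₂ (project-reachable a))

  A-W-structure : Σ (AbelianGroup 0ℓ 0ℓ) λ M → IsQuotientOf C-W M × Iso A-W (ℤ²⊕ M)
  A-W-structure = Kernel , Kernel-quotient , Split.split-iso

-- Interchanging the colours black and white gives again a coloured
-- triangulation; the black groups of Δ are the white groups of the
-- swapped triangulation.

iter-cancel : ∀ {A : Set} (f g : A → A) → (∀ x → g (f x) ≡ x) → ∀ m x → iter g m (iter f m x) ≡ x
iter-cancel f g gf zero    x = refl
iter-cancel f g gf (suc m) x = trans (iter-g-suc m (iter f m x)) (trans (cong (iter g m) (gf _)) (iter-cancel f g gf m x))
  where
  iter-g-suc : ∀ m a → iter g (suc m) (f a) ≡ iter g m (g (f a))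
  iter-g-suc zero    a = refl
  iter-g-suc (suc m) a = cong g (iter-g-suc m a)

-- If rotating with the gluings e₁, e₂ visits every white triangle with
-- the same f-value, then rotating with the inverse gluings visits every
-- black triangle with the same g-value (g (e₂ w) = f w): the black
-- rotation is conjugate, through e₂, to the inverse white rotation.
reverse-cycles : ∀ {nW nB : ℕ} {X : Set} (e₁ e₂ : Fin nW ↔ Fin nB) (f : Fin nW → X) (g : Fin nB → X) →
  (∀ w → g (Inverse.to e₂ w) ≡ f w) →
  (∀ w w′ → f w ≡ f w′ → ∃[ m ] iter (rot e₁ e₂) m w ≡ w′) →
  ∀ b b′ → g b ≡ g b′ → ∃[ m ] iter (rot (↔-sym e₁) (↔-sym e₂)) m b ≡ b′
reverse-cycles e₁ e₂ f g glued cycle b b′ same = m , (begin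
  iter rot′ m b                                    ≡⟨ cong (iter rot′ m) (Inverse.strictlyInverseˡ e₂ b) ⟨
  iter rot′ m (Inverse.to e₂ (from₂ b))            ≡⟨ conjugate m (from₂ b) ⟩
  Inverse.to e₂ (iter unrot m (from₂ b))           ≡⟨ cong (Inverse.to e₂ ∘ iter unrot m) rot^m≡ ⟨
  Inverse.to e₂ (iter unrot m (iter (rot e₁ e₂) m (from₂ b′)))
                                                   ≡⟨ cong (Inverse.to e₂) (iter-cancel (rot e₁ e₂) unrot unrot-rot m _) ⟩
  Inverse.to e₂ (from₂ b′)                         ≡⟨ Inverse.strictlyInverseˡ e₂ b′ ⟩
  b′                                               ∎)
  where
  open ≡-Reasoning
  from₂ = Inverse.from e₂
  same-f : f (from₂ b′) ≡ f (from₂ b)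
  same-f = trans (sym (glued _)) (trans (cong g (Inverse.strictlyInverseˡ e₂ b′))
             (trans (sym same) (trans (cong g (sym (Inverse.strictlyInverseˡ e₂ b))) (glued _))))
  m = proj₁ (cycle (from₂ b′) (from₂ b) same-f)
  rot^m≡ = proj₂ (cycle (from₂ b′) (from₂ b) same-f)
  rot′ = rot (↔-sym e₁) (↔-sym e₂)
  unrot : Fin _ → Fin _
  unrot w = Inverse.from e₁ (Inverse.to e₂ w)
  unrot-rot : ∀ w → unrot (rot e₁ e₂ w) ≡ w
  unrot-rot w = trans (cong (Inverse.from e₁) (Inverse.strictlyInverseˡ e₂ (Inverse.to e₁ w))) (Inverse.strictlyInverseʳ e₁ w)
  conjugate : ∀ m w → iter rot′ m (Inverse.to e₂ w) ≡ Inverse.to e₂ (iter unrot m w)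
  conjugate zero    w = refl
  conjugate (suc m) w = cong rot′ (conjugate m w)

swapColours : ColouredTriangulation → ColouredTriangulation
swapColours Δ = record
  { k = k ; nC = nC ; nS = nS ; nW = nB ; nB = nW
  ; wR = bR ; wC = bC ; wS = bS ; bR = wR ; bC = wC ; bS = wS
  ; eRC = ↔-sym eRC ; eRS = ↔-sym eRS ; eCS = ↔-sym eCS
  ; gRC = λ b → flipped eRC (proj₁ ∘ gRC) b , flipped eRC (proj₂ ∘ gRC) b
  ; gRS = λ b → flipped eRS (proj₁ ∘ gRS) b , flipped eRS (proj₂ ∘ gRS) b
  ; gCS = λ b → flipped eCS (proj₁ ∘ gCS) b , flipped eCS (proj₂ ∘ gCS) b
  ; nonempty = nonempty′ (Inverse.to eRC (fromℕ< nonempty))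
  ; connected = λ f g → subst₂ (EqClosure Adj′) (swap-involutive f) (swap-involutive g)
                          (gfold (isEquivalence Adj′) swap cross (connected (swap f) (swap g)))
  ; linkR = λ r → Inverse.to eRC (proj₁ (linkR r)) , trans (proj₁ (gRC _)) (proj₂ (linkR r))
  ; linkC = λ c → Inverse.to eRC (proj₁ (linkC c)) , trans (proj₂ (gRC _)) (proj₂ (linkC c))
  ; linkS = λ s → Inverse.to eRS (proj₁ (linkS s)) , trans (proj₂ (gRS _)) (proj₂ (linkS s))
  ; cycR = reverse-cycles eRC eRS wR bR (proj₁ ∘ gRS) cycR
  ; cycC = reverse-cycles eRC eCS wC bC (proj₁ ∘ gCS) cycC
  ; cycS = reverse-cycles eRS eCS wS bS (proj₂ ∘ gCS) cycS
  }
  where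
  open ColouredTriangulation Δ
  flipped : ∀ {X : Set} (e : Fin nW ↔ Fin nB) {f : Fin nW → X} {h : Fin nB → X} →
            (∀ w → h (Inverse.to e w) ≡ f w) → ∀ b → f (Inverse.from e b) ≡ h b
  flipped e {f} {h} glued b = trans (sym (glued (Inverse.from e b))) (cong h (Inverse.strictlyInverseˡ e b))
  nonempty′ : Fin nB → 0 < nB
  nonempty′ zero    = s≤s z≤n
  nonempty′ (suc _) = s≤s z≤n
  Adj′ = Adjacent (↔-sym eRC) (↔-sym eRS) (↔-sym eCS)
  reversed : (e : Fin nW ↔ Fin nB) → (∀ b → Adj′ (inj₁ b) (inj₂ (Inverse.from e b))) →
             ∀ w → EqClosure Adj′ (inj₂ w) (inj₁ (Inverse.to e w))
  reversed e adj w = symmetric Adj′ (return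
    (subst (λ t → Adj′ (inj₁ (Inverse.to e w)) (inj₂ t)) (Inverse.strictlyInverseʳ e w) (adj (Inverse.to e w))))
  cross : ∀ {f g} → Adjacent eRC eRS eCS f g → EqClosure Adj′ (swap f) (swap g)
  cross (adj₁ w) = reversed eRC adj₁ w
  cross (adj₂ w) = reversed eRS adj₂ w
  cross (adj₃ w) = reversed eCS adj₃ w

zeroRowSum-cong : ∀ {k} {off off′ : Fin k → Fin k → ℕ} → (∀ i j → + off i j ≡ + off′ i j) →
                  ∀ i j → zeroRowSum off i j ≡ zeroRowSum off′ i j
zeroRowSum-cong {off = off} {off′} same i j with ⌊ i ≟ j ⌋
... | true  = cong -_ (sum-cong (λ j′ → cong (if ⌊ i ≟ j′ ⌋ then 0ℤ else_) (same i j′)))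
... | false = same i j

module BlackGroups (Δ : ColouredTriangulation) where
  open Triangulation Δ
  module Δ′ = Groups (swapColours Δ)

  -- T′ of Δ counts the same CS-edges as T of the swapped triangulation,
  -- indexed by black instead of white triangles
  same-edges : ∀ i j →
    + count (λ w → ⌊ bR (β w) ≟ j ⌋ ∧ ⌊ wR w ≟ i ⌋) ≡ + count (λ b → ⌊ bR b ≟ j ⌋ ∧ ⌊ wR (Inverse.from eCS b) ≟ i ⌋)
  same-edges i j = begin
    + count (λ w → ⌊ bR (β w) ≟ j ⌋ ∧ ⌊ wR w ≟ i ⌋)          ≡⟨ count≡sum (λ w → ⌊ bR (β w) ≟ j ⌋ ∧ ⌊ wR w ≟ i ⌋) ⟩
    sumℤ (λ w → edge (β w) w)                                  ≡⟨ sum-cong (λ w → cong (edge (β w)) (sym (Inverse.strictlyInverseʳ eCS w))) ⟩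
    sumℤ (λ w → edge (β w) (Inverse.from eCS (β w)))           ≡⟨ sum-reindex eCS (λ b → edge b (Inverse.from eCS b)) ⟩
    sumℤ (λ b → edge b (Inverse.from eCS b))                   ≡⟨ count≡sum (λ b → ⌊ bR b ≟ j ⌋ ∧ ⌊ wR (Inverse.from eCS b) ≟ i ⌋) ⟨
    + count (λ b → ⌊ bR b ≟ j ⌋ ∧ ⌊ wR (Inverse.from eCS b) ≟ i ⌋) ∎
    where
    open ≡-Reasoning
    edge : Fin nB → Fin nW → ℤ
    edge b w = if ⌊ bR b ≟ j ⌋ ∧ ⌊ wR w ≟ i ⌋ then 1ℤ else 0ℤ

  B-B≅B-W′ : Iso B-B Δ′.B-W
  B-B≅B-W′ = ext-iso T′ Δ′.T (zeroRowSum-cong same-edges)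

  A-B≅A-W′ : Iso A-B Δ′.A-W
  A-B≅A-W′ = ext-iso (λ b → triRel (bR b) (bC b) (bS b)) (λ b → Δ′.triRel (bR b) (bC b) (bS b))
    λ b → λ { (inj₁ r) → refl ; (inj₂ (inj₁ c)) → refl ; (inj₂ (inj₂ s)) → refl }

  C-W≅C-W′ : Iso C-W Δ′.C-W
  C-W≅C-W′ = IsoProperties.onTorsion {B-W} {Δ′.B-W} (isoTrans {B-W} {B-B} {Δ′.B-W} B-W≅B-B B-B≅B-W′)

theorem9 : (Δ : ColouredTriangulation) →
    let open Groups Δ in
    _≅_ B-W B-B
    × FiniteGroup C-W
    × (Σ (AbelianGroup 0ℓ 0ℓ) λ M → IsQuotientOf C-W M × _≅_ A-W (ℤ²⊕ M))
    × (Σ (AbelianGroup 0ℓ 0ℓ) λ N → IsQuotientOf C-W N × _≅_ A-B (ℤ²⊕ N))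
theorem9 Δ =
  iso⇒≅ B-W≅B-B ,
  SquarePresentation.torsion-finite T ,
  (M , C-W↠M , iso⇒≅ A-W≅ℤ²⊕M) ,
  (N , quotient-along-iso {C-W} {Δ′.C-W} {N} C-W≅C-W′ C-W′↠N ,
       iso⇒≅ (isoTrans {A-B} {Δ′.A-W} {ℤ²⊕ N} A-B≅A-W′ A-W′≅ℤ²⊕N))
  where
  open Triangulation Δ
  open BlackGroups Δ
  M = proj₁ (WhiteGroups.A-W-structure Δ)
  C-W↠M = proj₁ (proj₂ (WhiteGroups.A-W-structure Δ))
  A-W≅ℤ²⊕M = proj₂ (proj₂ (WhiteGroups.A-W-structure Δ))
  N = proj₁ (WhiteGroups.A-W-structure (swapColours Δ))
  C-W′↠N = proj₁ (proj₂ (WhiteGroups.A-W-structure (swapColours Δ)))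
  A-W′≅ℤ²⊕N = proj₂ (proj₂ (WhiteGroups.A-W-structure (swapColours Δ)))
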